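{- Fix a positive integer $k$ and a prime $p$, and let $f=\sum_{n\gg-\infty}a(n)q^n$ be a Laurent series. Then: (a) $\Psi(f)\,|\,\mathcal{T}_p^n=\Psi(f\,|\,T_{p^2}^n)$ for $n=1,2,\dots$; (b) $\Psi(f)=\Psi(f^{\square})$; (c) $(f|U_{p^2})^{\square}=f^{\square}|U_{p^2}$, $(f|V_{p^2})^{\square}=f^{\square}|V_{p^2}$ and $(f|\chi_p)^{\square}=f^{\square}|\chi_p$, hence $(f|T_{p^2})^{\square}=f^{\square}|T_{p^2}$; (d) if the coefficients of $f$ are integers and $k\ge2$, then $f|T_{p^2}\equiv f|U_{p^2}\pmod p$ coefficientwise.
   Context: Let $D_k=1$ if $k$ is even and $D_k=-3$ if $k$ is odd. $\Psi(f)=\sum_{n>0}q^n\sum_{d\mid n}\big(\frac{d}{D_k}\big)d^{k-1}a(|D_k|n^2/d^2)$ (Kronecker symbol) and $f^{\square}=\sum_{n>0}a(|D_k|n^2)q^{|D_k|n^2}$. For Laurent series: $f|U_m=\sum a(mn)q^n$, $f|V_m=\sum a(n)q^{mn}$, $f|\chi=\sum\chi(n)a(n)q^n$. The weight-$2k$ Hecke operator is $F|\mathcal{T}_p=F|U_p+p^{2k-1}F|V_p$; the weight-$(k+1/2)$ operator is $f|T_{p^2}=f|U_{p^2}+p^{k-1}f|\chi_p+p^{2k-1}f|V_{p^2}$ with $\chi_p(n)=\big(\frac{(-1)^kn}{p}\big)$ the Kronecker symbol. -}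

module Defs where

open import Level using (Level)
open import Algebra.Bundles using (CommutativeRing)
open import Data.Bool using (Bool; true; false; if_then_else_)
open import Data.Nat as ℕ using (ℕ; zero; suc; _≡ᵇ_; _∸_)
open import Data.Nat.DivMod using (_%_; _/_)
open import Data.Nat.Divisibility using (_∣?_)
open import Data.Integer as ℤ using (ℤ; +_; -[1+_]; ∣_∣)
open import Data.Integer.DivMod using (_%ℕ_; _/ℕ_)
open import Data.List using (List; upTo; map; foldr)
open import Data.Bool.ListAction using (any)
open import Data.Product using (∃)
open import Relation.Nullary.Decidable using (does)

isEven : ℕ → Bool
isEven k = k % 2 ≡ᵇ 0

-- |D_k| : 1 if k even, 3 if k odd  (D_k = 1 resp. -3)
absD : ℕ → ℕ
absD k = if isEven k then 1 else 3

-- Kronecker symbol (a / -1) : the sign of a (with (0 / -1) = 1)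
kronNeg1 : ℤ → ℤ
kronNeg1 (+ _)    = ℤ.1ℤ
kronNeg1 -[1+ _ ] = ℤ.-1ℤ

-- Kronecker symbol (a / p) for a prime p.
--  p = 2 : 0 if a even, 1 if a ≡ ±1 (mod 8), -1 if a ≡ ±3 (mod 8);
--  p odd : Legendre symbol: 0 if p ∣ a, 1 if a is a nonzero square mod p, -1 otherwise.
-- (The values at p = 0, 1 are irrelevant: p is always prime below.)
kronP : ℤ → ℕ → ℤ
kronP a 0 = ℤ.0ℤ
kronP a 1 = ℤ.0ℤ
kronP a 2 with a %ℕ 8
... | 1 = ℤ.1ℤ
... | 7 = ℤ.1ℤ
... | 3 = ℤ.-1ℤ
... | 5 = ℤ.-1ℤ
... | _ = ℤ.0ℤ
kronP a (suc (suc (suc q))) =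
  let p = suc (suc (suc q))
      r = a %ℕ p
  in if r ≡ᵇ 0 then ℤ.0ℤ
     else if any (λ x → (x ℕ.* x) % p ≡ᵇ r) (upTo p) then ℤ.1ℤ else ℤ.-1ℤ

-- Kronecker symbol (d / D_k) for d : ℕ.  (d / 1) = 1 and (d / -3) = (d / -1)(d / 3).
kronD : ℕ → ℕ → ℤ
kronD k d = if isEven k then ℤ.1ℤ else kronNeg1 (+ d) ℤ.* kronP (+ d) 3

chiP : ℕ → ℕ → ℤ → ℤ
chiP k p n = kronP (if isEven k then n else ℤ.- n) p

isDSquare : ℕ → ℕ → Bool
isDSquare k n = any (λ m → absD k ℕ.* (m ℕ.* m) ≡ᵇ n) (map suc (upTo n))

iter : ∀ {a} {A : Set a} → ℕ → (A → A) → A → A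
iter zero    g x = x
iter (suc n) g x = g (iter n g x)

-- Laurent series with coefficients in a commutative ring R,
-- represented by their coefficient function  n ↦ a(n),  n ∈ ℤ.

module _ {c ℓ : Level} (R : CommutativeRing c ℓ) where
  open CommutativeRing R

  Series : Set c
  Series = ℤ → Carrier

  IsLaurent : Series → Set ℓ
  IsLaurent a = ∃ λ (N : ℤ) → ∀ n → n ℤ.< N → a n ≈ 0#

  _≋_ : Series → Series → Set ℓ
  F ≋ G = ∀ n → F n ≈ G n

  ιℕ : ℕ → Carrier
  ιℕ zero    = 0#
  ιℕ (suc n) = 1# + ιℕ n

  ι : ℤ → Carrier
  ι (+ n)    = ιℕ n
  ι -[1+ n ] = - ιℕ (suc n)

  _⊕_ : Series → Series → Series
  (F ⊕ G) n = F n + G n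

  _⊙_ : Carrier → Series → Series
  (x ⊙ F) n = x * F n

  U : ℕ → Series → Series
  U m a n = a (+ m ℤ.* n)

  V : ℕ → Series → Series
  V zero    a n = 0#
  V (suc j) a n = if does (suc j ∣? ∣ n ∣) then a (n /ℕ suc j) else 0#

  twist : (ℤ → ℤ) → Series → Series
  twist χ a n = ι (χ n) * a n

  -- weight 2k Hecke operator  F | 𝒯_p = F|U_p + p^{2k-1} F|V_p
  𝒯 : ℕ → ℕ → Series → Series
  𝒯 k p F = U p F ⊕ (ι (+ (p ℕ.^ (2 ℕ.* k ∸ 1))) ⊙ V p F)

  -- weight k+1/2 Hecke operator
  -- f | T_{p²} = f|U_{p²} + p^{k-1} f|χ_p + p^{2k-1} f|V_{p²}
  T : ℕ → ℕ → Series → Series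
  T k p f = (U (p ℕ.* p) f ⊕ (ι (+ (p ℕ.^ (k ∸ 1))) ⊙ twist (chiP k p) f))
            ⊕ (ι (+ (p ℕ.^ (2 ℕ.* k ∸ 1))) ⊙ V (p ℕ.* p) f)

  -- Ψ(f) = Σ_{n>0} qⁿ Σ_{d∣n} (d / D_k) d^{k-1} a(|D_k| n²/d²)
  Ψ : ℕ → Series → Series
  Ψ k a (+ zero)  = 0#
  Ψ k a -[1+ _ ]  = 0#
  Ψ k a (+ suc m) = foldr _+_ 0# (map term (upTo (suc m)))
    where
      n = suc m
      term : ℕ → Carrier
      term i = if does (suc i ∣? n)
               then ι (kronD k (suc i) ℤ.* + (suc i ℕ.^ (k ∸ 1)))
                      * a (+ (absD k ℕ.* ((n / suc i) ℕ.* (n / suc i))))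
               else 0#

  square : ℕ → Series → Series
  square k a (+ m)    = if isDSquare k m then a (+ m) else 0#
  square k a -[1+ _ ] = 0#

module Submission where

-- Ψ(f) is the divisor sum ∑_{d ∣ n} w(d) a(|D_k| (n/d)²) with w(d) = (d / D_k) d^(k−1).
-- Evaluating f | T_{p²} at |D_k| e², the U-part contributes the divisors d of pn with d ∣ n,
-- the χ_p-part the divisors p·d of pn with d ∤ n (because χ_p(|D_k| e²) = (p / D_k) when
-- p ∤ e and w is multiplicative), and the V-part the divisors of n/p; together they give
-- Ψ(f) | U_p + p^(2k−1) Ψ(f) | V_p, and (a) follows by iteration. The arithmetic input is
-- (−3 / p) = (p / 3) for p ≥ 5, proved with cube roots of unity modulo p: Fermat's little
-- theorem gives one direction, and the vanishing of the power sums ∑_{a<p} a^j modulo p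
-- (0 < j < p − 1) yields an element of order 3 for the other.
-- Parts (b)–(d) are coefficientwise: Ψ only reads the coefficients at |D_k| e², the operators
-- U_{p²}, V_{p²} and twists preserve that set of indices, and for k ≥ 2 the extra terms of
-- T_{p²} carry a factor p.

open import Level using (Level)
open import Defs
open import Algebra.Bundles using (CommutativeSemiring; CommutativeRing)
open import Data.Nat as ℕ using (ℕ; zero; suc; _≤_; _<_; z≤n; s≤s)
import Data.Nat.Properties as ℕP
open import Data.Nat.Primality using (Prime; prime?)
open import Relation.Nullary.Decidable using (from-yes)
open import Data.Nat.Tactic.RingSolver using (solve-∀)
open import Relation.Binary.PropositionalEquality as Eq using (_≡_)

prime[3] : Prime 3
prime[3] = from-yes (prime? 3)

module FiniteSum {c ℓ : Level} (S : CommutativeSemiring c ℓ) where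
  open CommutativeSemiring S
    using (Carrier; _≈_; _+_; _*_; 0#; refl; sym; trans; setoid; +-cong; +-identityˡ; +-identityʳ; +-assoc;
           +-comm; zeroʳ; distribˡ; reflexive)
  open import Algebra.Properties.CommutativeSemigroup
    (CommutativeSemiring.+-commutativeSemigroup S) using (interchange; xy∙z≈xz∙y)
  open import Data.Nat.Divisibility using (_∣_; ∣⇒≤; ∣m+n∣m⇒∣n; m∣m*n)
  open import Relation.Nullary using (¬_)
  open import Data.List using (foldr; map; applyUpTo)

  ∑ : ℕ → (ℕ → Carrier) → Carrier
  ∑ zero    f = 0#
  ∑ (suc n) f = ∑ n f + f n

  ∑-cong : ∀ n {f g} → (∀ i → i < n → f i ≈ g i) → ∑ n f ≈ ∑ n g
  ∑-cong zero    eq = refl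
  ∑-cong (suc n) eq = +-cong (∑-cong n (λ i i<n → eq i (ℕP.m≤n⇒m≤1+n i<n))) (eq n ℕP.≤-refl)

  ∑-zero : ∀ n {f} → (∀ i → i < n → f i ≈ 0#) → ∑ n f ≈ 0#
  ∑-zero zero    eq = refl
  ∑-zero (suc n) eq = trans (+-cong (∑-zero n (λ i i<n → eq i (ℕP.m≤n⇒m≤1+n i<n))) (eq n ℕP.≤-refl)) (+-identityˡ 0#)

  ∑-distrib-+ : ∀ n f g → ∑ n (λ i → f i + g i) ≈ ∑ n f + ∑ n g
  ∑-distrib-+ zero    f g = sym (+-identityˡ 0#)
  ∑-distrib-+ (suc n) f g = trans (+-cong (∑-distrib-+ n f g) refl) (interchange (∑ n f) (∑ n g) (f n) (g n))

  ∑-*ˡ : ∀ n x f → ∑ n (λ i → x * f i) ≈ x * ∑ n f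
  ∑-*ˡ zero    x f = sym (zeroʳ x)
  ∑-*ˡ (suc n) x f = trans (+-cong (∑-*ˡ n x f) refl) (sym (distribˡ x (∑ n f) (f n)))

  ∑-unconsˡ : ∀ n f → ∑ (suc n) f ≈ f 0 + ∑ n (λ i → f (suc i))
  ∑-unconsˡ zero    f = trans (+-identityˡ (f 0)) (sym (+-identityʳ (f 0)))
  ∑-unconsˡ (suc n) f = trans (+-cong (∑-unconsˡ n f) refl) (+-assoc (f 0) _ _)

  ∑-split : ∀ m n f → ∑ (m ℕ.+ n) f ≈ ∑ m f + ∑ n (λ i → f (m ℕ.+ i))
  ∑-split m zero    f = trans (reflexive (Eq.cong (λ z → ∑ z f) (ℕP.+-identityʳ m))) (sym (+-identityʳ _))
  ∑-split m (suc n) f = trans (reflexive (Eq.cong (λ z → ∑ z f) (ℕP.+-suc m n)))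
                          (trans (+-cong (∑-split m n f) refl) (+-assoc (∑ m f) _ _))

  ∑-extend : ∀ n m f → (∀ i → n ≤ i → i < n ℕ.+ m → f i ≈ 0#) → ∑ (n ℕ.+ m) f ≈ ∑ n f
  ∑-extend n m f f≈0 = trans (∑-split n m f)
    (trans (+-cong refl (∑-zero m (λ i i<m → f≈0 (n ℕ.+ i) (ℕP.m≤m+n n i) (ℕP.+-monoʳ-< n i<m)))) (+-identityʳ _))

  ∑-multiples : ∀ p₀ N f → (∀ i → ¬ suc p₀ ∣ suc i → f i ≈ 0#) → ∑ (suc p₀ ℕ.* N) f ≈ ∑ N (λ j → f (p₀ ℕ.+ suc p₀ ℕ.* j))
  ∑-multiples p₀ zero    f f≈0 = reflexive (Eq.cong (λ z → ∑ z f) (ℕP.*-zeroʳ p₀))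
  ∑-multiples p₀ (suc N) f f≈0 = begin
      ∑ (p ℕ.* suc N) f
        ≡⟨ Eq.cong (λ z → ∑ z f) (Eq.trans (ℕP.*-suc p N) (ℕP.+-comm p (p ℕ.* N))) ⟩
      ∑ (p ℕ.* N ℕ.+ p) f
        ≈⟨ ∑-split (p ℕ.* N) p f ⟩
      ∑ (p ℕ.* N) f + (∑ p₀ (λ i → f (p ℕ.* N ℕ.+ i)) + f (p ℕ.* N ℕ.+ p₀))
        ≈⟨ +-cong (∑-multiples p₀ N f f≈0) (+-cong (∑-zero p₀ gap≈0) (reflexive (Eq.cong f (ℕP.+-comm (p ℕ.* N) p₀)))) ⟩
      ∑ N (λ j → f (p₀ ℕ.+ p ℕ.* j)) + (0# + f (p₀ ℕ.+ p ℕ.* N))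
        ≈⟨ +-cong refl (+-identityˡ _) ⟩
      ∑ (suc N) (λ j → f (p₀ ℕ.+ p ℕ.* j)) ∎
    where
      open import Relation.Binary.Reasoning.Setoid setoid
      p = suc p₀
      gap≈0 : ∀ i → i < p₀ → f (p ℕ.* N ℕ.+ i) ≈ 0#
      gap≈0 i i<p₀ = f≈0 (p ℕ.* N ℕ.+ i) λ p∣ → ℕP.<⇒≱ (s≤s i<p₀)
        (∣⇒≤ (∣m+n∣m⇒∣n (Eq.subst (p ∣_) (Eq.sym (ℕP.+-suc (p ℕ.* N) i)) p∣) (m∣m*n N)))

  foldr-applyUpTo : ∀ (f : ℕ → Carrier) h n → foldr _+_ 0# (map f (applyUpTo h n)) ≈ ∑ n (λ i → f (h i))
  foldr-applyUpTo f h zero    = refl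
  foldr-applyUpTo f h (suc n) = trans (+-cong refl (foldr-applyUpTo f (λ i → h (suc i)) n)) (sym (∑-unconsˡ n (λ i → f (h i))))

  ∑-swap : ∀ m n (g : ℕ → ℕ → Carrier) → ∑ m (λ a → ∑ n (g a)) ≈ ∑ n (λ i → ∑ m (λ a → g a i))
  ∑-swap zero    n g = sym (∑-zero n (λ _ _ → refl))
  ∑-swap (suc m) n g = trans (+-cong (∑-swap m n g) refl) (sym (∑-distrib-+ n (λ i → ∑ m (λ a → g a i)) (g m)))

  ∑-telescope : ∀ n f → ∑ n (λ i → f (suc i)) + f 0 ≈ ∑ n f + f n
  ∑-telescope zero    f = refl
  ∑-telescope (suc n) f = trans (xy∙z≈xz∙y (∑ n (λ i → f (suc i))) (f (suc n)) (f 0))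
                                (+-cong (∑-telescope n f) refl)

module NatSum where
  open FiniteSum ℕP.+-*-commutativeSemiring public
  open import Data.Nat using (_+_)
  open import Data.Nat.Divisibility using (_∣_; _∣0; ∣m∣n⇒∣m+n)

  ∑-ones : ∀ n → ∑ n (λ _ → 1) ≡ n
  ∑-ones zero    = Eq.refl
  ∑-ones (suc n) = Eq.trans (Eq.cong (_+ 1) (∑-ones n)) (ℕP.+-comm n 1)

  ∣-∑ : ∀ {d} n {f} → (∀ i → i < n → d ∣ f i) → d ∣ ∑ n f
  ∣-∑ zero    d∣f = _ ∣0
  ∣-∑ (suc n) d∣f = ∣m∣n⇒∣m+n (∣-∑ n (λ i i<n → d∣f i (ℕP.m≤n⇒m≤1+n i<n))) (d∣f n ℕP.≤-refl)

module Binomial where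
  open import Data.Nat
  open import Data.Nat.Properties
  open Eq
  open ≡-Reasoning
  open import Data.Nat.Combinatorics
  open NatSum

  suc-C-suc : ∀ n k → suc k * (suc n C suc k) ≡ suc n * (n C k)
  suc-C-suc n zero = trans (+-identityʳ (suc n C 1)) (trans (nC1≡n (suc n)) (sym (*-identityʳ (suc n))))
  suc-C-suc zero (suc k) = *-zeroʳ (suc (suc k))
  suc-C-suc (suc n) (suc k) = begin
      suc (suc k) * (suc (suc n) C suc (suc k))
        ≡⟨ cong (suc (suc k) *_) (sym (nCk+nC[k+1]≡[n+1]C[k+1] (suc n) (suc k))) ⟩
      suc (suc k) * (suc n C suc k + suc n C suc (suc k))
        ≡⟨ *-distribˡ-+ (suc (suc k)) (suc n C suc k) _ ⟩
      suc n C suc k + suc k * (suc n C suc k) + suc (suc k) * (suc n C suc (suc k))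
        ≡⟨ cong₂ (λ x y → suc n C suc k + x + y) (suc-C-suc n k) (suc-C-suc n (suc k)) ⟩
      suc n C suc k + suc n * (n C k) + suc n * (n C suc k)
        ≡⟨ +-assoc (suc n C suc k) _ _ ⟩
      suc n C suc k + (suc n * (n C k) + suc n * (n C suc k))
        ≡⟨ cong (suc n C suc k +_) (sym (*-distribˡ-+ (suc n) (n C k) _)) ⟩
      suc n C suc k + suc n * (n C k + n C suc k)
        ≡⟨ cong (λ x → suc n C suc k + suc n * x) (nCk+nC[k+1]≡[n+1]C[k+1] n k) ⟩
      suc (suc n) * (suc n C suc k) ∎

  suc-C-self : ∀ n → suc n C n ≡ suc n
  suc-C-self n = begin
    suc n C n             ≡⟨ nCk≡nC[n∸k] (n≤1+n n) ⟩
    suc n C (suc n ∸ n)   ≡⟨ cong (suc n C_) (trans (+-∸-assoc 1 (≤-refl {n})) (cong suc (n∸n≡0 n))) ⟩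
    suc n C 1             ≡⟨ nC1≡n (suc n) ⟩
    suc n                 ∎

  binomial-theorem : ∀ a n → (a + 1) ^ n ≡ ∑ (suc n) (λ i → (n C i) * a ^ i)
  binomial-theorem a zero = refl
  binomial-theorem a (suc n) = begin
      (a + 1) * (a + 1) ^ n
        ≡⟨ cong ((a + 1) *_) (binomial-theorem a n) ⟩
      (a + 1) * ∑ (suc n) F
        ≡⟨ *-distribʳ-+ (∑ (suc n) F) a 1 ⟩
      a * ∑ (suc n) F + 1 * ∑ (suc n) F
        ≡⟨ cong₂ _+_ (sym (∑-*ˡ (suc n) a F)) (trans (*-identityˡ _) (sym (trans (cong (∑ (suc n) F +_) top) (+-identityʳ _)))) ⟩
      ∑ (suc n) (λ i → a * F i) + ∑ (suc (suc n)) F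
        ≡⟨ cong₂ _+_ (∑-cong (suc n) (λ i _ → x∙yz≈y∙xz a (n C i) (a ^ i))) (∑-unconsˡ (suc n) F) ⟩
      ∑ (suc n) (λ i → (n C i) * a ^ suc i) + (1 + ∑ (suc n) (λ i → (n C suc i) * a ^ suc i))
        ≡⟨ +-suc _ _ ⟩
      1 + (∑ (suc n) (λ i → (n C i) * a ^ suc i) + ∑ (suc n) (λ i → (n C suc i) * a ^ suc i))
        ≡⟨ cong (1 +_) (sym (∑-distrib-+ (suc n) _ _)) ⟩
      1 + ∑ (suc n) (λ i → (n C i) * a ^ suc i + (n C suc i) * a ^ suc i)
        ≡⟨ cong (1 +_) (∑-cong (suc n) (λ i _ → trans (sym (*-distribʳ-+ (a ^ suc i) (n C i) _))
                                                      (cong (_* a ^ suc i) (nCk+nC[k+1]≡[n+1]C[k+1] n i)))) ⟩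
      1 + ∑ (suc n) (λ i → (suc n C suc i) * a ^ suc i)
        ≡⟨ sym (∑-unconsˡ (suc n) (λ i → (suc n C i) * a ^ i)) ⟩
      ∑ (suc (suc n)) (λ i → (suc n C i) * a ^ i) ∎
    where
      open import Algebra.Properties.CommutativeSemigroup *-commutativeSemigroup using (x∙yz≈y∙xz)
      F : ℕ → ℕ
      F i = (n C i) * a ^ i
      top : F (suc n) ≡ 0
      top = cong (_* a ^ suc n) (k>n⇒nCk≡0 {n} {suc n} (n<1+n n))

module Congruence (m : ℕ) .{{_ : ℕ.NonZero m}} where
  open import Data.Nat
  open import Data.Nat.Properties
  open import Data.Nat.DivMod
  open import Data.Nat.Divisibility
  open Eq
  open NatSum using (∑)
  open import Relation.Binary.Bundles using (Setoid)
  open import Relation.Nullary using (Dec)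
  import Relation.Nullary.Decidable as Dec

  infix 4 _≈_ _≈?_
  record _≈_ (a b : ℕ) : Set where
    constructor mk
    field get : a % m ≡ b % m

  ≈-refl : ∀ {a} → a ≈ a
  ≈-refl = mk refl

  ≈-sym : ∀ {a b} → a ≈ b → b ≈ a
  ≈-sym (mk e) = mk (sym e)

  ≈-trans : ∀ {a b c} → a ≈ b → b ≈ c → a ≈ c
  ≈-trans (mk e) (mk e′) = mk (trans e e′)

  ≈-reflexive : ∀ {a b} → a ≡ b → a ≈ b
  ≈-reflexive refl = ≈-refl

  ≈-setoid : Setoid _ _
  ≈-setoid = record { Carrier = ℕ ; _≈_ = _≈_
                    ; isEquivalence = record { refl = ≈-refl ; sym = ≈-sym ; trans = ≈-trans } }

  _≈?_ : ∀ a b → Dec (a ≈ b)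
  a ≈? b = Dec.map′ mk _≈_.get (a % m ≟ b % m)

  ≈-+ : ∀ {a b c d} → a ≈ b → c ≈ d → a + c ≈ b + d
  ≈-+ {a} {b} {c} {d} (mk e) (mk e′) =
    mk (trans (%-distribˡ-+ a c m) (trans (cong₂ (λ x y → (x + y) % m) e e′) (sym (%-distribˡ-+ b d m))))

  ≈-* : ∀ {a b c d} → a ≈ b → c ≈ d → a * c ≈ b * d
  ≈-* {a} {b} {c} {d} (mk e) (mk e′) =
    mk (trans (%-distribˡ-* a c m) (trans (cong₂ (λ x y → (x * y) % m) e e′) (sym (%-distribˡ-* b d m))))

  ≈-∑ : ∀ n {f g} → (∀ i → i < n → f i ≈ g i) → ∑ n f ≈ ∑ n g
  ≈-∑ zero    e = ≈-refl
  ≈-∑ (suc n) e = ≈-+ (≈-∑ n (λ i i<n → e i (m≤n⇒m≤1+n i<n))) (e n ≤-refl)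

  %-≈ : ∀ a → a % m ≈ a
  %-≈ a = mk (m%n%n≡m%n a m)

  private
    0%m≡0 : 0 % m ≡ 0
    0%m≡0 = n≤0⇒n≡0 (m%n≤m 0 m)

  ∣⇒≈0 : ∀ {a} → m ∣ a → a ≈ 0
  ∣⇒≈0 {a} m∣a = mk (trans (n∣m⇒m%n≡0 a m m∣a) (sym 0%m≡0))

  ≈0⇒∣ : ∀ {a} → a ≈ 0 → m ∣ a
  ≈0⇒∣ {a} (mk e) = m%n≡0⇒n∣m a m (trans e 0%m≡0)

  +-∣-≈ : ∀ a {d} → m ∣ d → a + d ≈ a
  +-∣-≈ a (divides q refl) = mk ([m+kn]%n≡m%n a q m)

  ≈-+-cancelʳ : ∀ {a b} c → a + c ≈ b + c → a ≈ b
  ≈-+-cancelʳ {a} {b} c e = begin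
      a                        ≈⟨ shift a ⟨
      a + c + (m ∸ c % m)      ≈⟨ ≈-+ e ≈-refl ⟩
      b + c + (m ∸ c % m)      ≈⟨ shift b ⟩
      b                        ∎
    where
      open import Relation.Binary.Reasoning.Setoid ≈-setoid
      shift : ∀ x → x + c + (m ∸ c % m) ≈ x
      shift x = begin
        x + c + (m ∸ c % m)        ≈⟨ ≈-+ (≈-+ {x} ≈-refl (%-≈ c)) ≈-refl ⟨
        x + c % m + (m ∸ c % m)    ≡⟨ trans (+-assoc x (c % m) _) (cong (x +_) (m+[n∸m]≡n (m%n≤n c m))) ⟩
        x + m                      ≈⟨ +-∣-≈ x ∣-refl ⟩
        x                          ∎

  ≈-+⇒∣ : ∀ a d → a + d ≈ a → m ∣ d
  ≈-+⇒∣ a d e = ≈0⇒∣ (≈-+-cancelʳ a (≈-trans (≈-reflexive (+-comm d a)) e))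

module ModPrime (p₀ : ℕ) (p-prime : Prime (suc p₀)) where
  open import Data.Nat
  open import Data.Nat.Properties
  open import Data.Nat.Divisibility
  open import Data.Nat.Primality using (euclidsLemma; prime⇒nonTrivial; composite; module Prime)
  open import Data.Nat.Combinatorics using (_C_; nCn≡1)
  open import Data.Nat.DivMod using (m%n<n; m≡m%n+[m/n]*n)
  open import Data.Sum using (inj₁; inj₂)
  open import Data.Product using (∃; _×_; _,_)
  open import Data.Empty using (⊥-elim)
  open import Relation.Nullary using (¬_; Dec; yes; no; ¬?)
  open import Relation.Nullary.Decidable using (decidable-stable)
  open Eq
  open NatSum
  open Binomial
  open Congruence (suc p₀) public

  p : ℕ
  p = suc p₀

  1<p : 1 < p
  1<p = nonTrivial⇒n>1 p {{prime⇒nonTrivial p-prime}}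

  ∤-positive-< : ∀ {x} → 0 < x → x < p → ¬ p ∣ x
  ∤-positive-< {suc x} _ x<p p∣x = <⇒≱ x<p (∣⇒≤ p∣x)

  ≈-*-cancelˡ-≤ : ∀ {c a b} → ¬ p ∣ c → b ≤ a → c * a ≈ c * b → a ≈ b
  ≈-*-cancelˡ-≤ {c} {a} {b} p∤c b≤a e with euclidsLemma c (a ∸ b) p-prime (≈-+⇒∣ (c * b) (c * (a ∸ b)) e′)
    where
      e′ : c * b + c * (a ∸ b) ≈ c * b
      e′ = ≈-trans (≈-reflexive (trans (sym (*-distribˡ-+ c b _)) (cong (c *_) (m+[n∸m]≡n b≤a)))) e
  ... | inj₁ p∣c   = ⊥-elim (p∤c p∣c)
  ... | inj₂ p∣a∸b = subst (_≈ b) (m+[n∸m]≡n b≤a) (+-∣-≈ b p∣a∸b)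

  ≈-*-cancelˡ : ∀ {c a b} → ¬ p ∣ c → c * a ≈ c * b → a ≈ b
  ≈-*-cancelˡ {c} {a} {b} p∤c e with ≤-total b a
  ... | inj₁ b≤a = ≈-*-cancelˡ-≤ p∤c b≤a e
  ... | inj₂ a≤b = ≈-sym (≈-*-cancelˡ-≤ p∤c a≤b (≈-sym e))

  ∣-*-cancelˡ : ∀ {c u} → ¬ p ∣ c → p ∣ c * u → p ∣ u
  ∣-*-cancelˡ {c} {u} p∤c p∣cu with euclidsLemma c u p-prime p∣cu
  ... | inj₁ p∣c = ⊥-elim (p∤c p∣c)
  ... | inj₂ p∣u = p∣u

  p∣pCk : ∀ k → suc k < p → p ∣ p C suc k
  p∣pCk k k+1<p = ∣-*-cancelˡ (∤-positive-< (s≤s z≤n) k+1<p)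
                    (divides (p₀ C k) (trans (suc-C-suc p₀ k) (*-comm p _)))

  fermat : ∀ a → a ^ p ≈ a
  fermat zero    = ≈-refl
  fermat (suc a) = begin
      suc a ^ p                                         ≡⟨ cong (_^ p) (+-comm 1 a) ⟩
      (a + 1) ^ p                                       ≡⟨ binomial-theorem a p ⟩
      ∑ (suc p) F                                       ≡⟨ cong (_+ F p) (∑-unconsˡ p₀ F) ⟩
      1 + ∑ p₀ (λ i → F (suc i)) + (p C p) * a ^ p      ≈⟨ ≈-+ (≈-+ {1} ≈-refl middle≈0) ≈-refl ⟩
      1 + 0 + (p C p) * a ^ p                           ≡⟨ cong (λ c → 1 + c * a ^ p) (nCn≡1 p) ⟩
      1 + (1 * a ^ p)                                   ≈⟨ ≈-+ {1} ≈-refl (≈-trans (≈-reflexive (*-identityˡ _)) (fermat a)) ⟩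
      suc a                                             ∎
    where
      open import Relation.Binary.Reasoning.Setoid ≈-setoid
      F : ℕ → ℕ
      F i = (p C i) * a ^ i
      middle≈0 : ∑ p₀ (λ i → F (suc i)) ≈ 0
      middle≈0 = ≈-trans (≈-∑ p₀ (λ i i<p₀ → ≈-* (∣⇒≈0 (p∣pCk i (s≤s i<p₀))) ≈-refl)) (≈-reflexive (∑-zero p₀ (λ _ _ → refl)))

  fermat-unit : ∀ {a} → ¬ p ∣ a → a ^ p₀ ≈ 1
  fermat-unit {a} p∤a = ≈-*-cancelˡ p∤a (≈-trans (fermat a) (≈-reflexive (sym (*-identityʳ a))))

  powerSum : ℕ → ℕ
  powerSum j = ∑ p (λ a → a ^ j)

  -- ∑_{a<p} ((a+1)^(n+1) − a^(n+1)) telescopes to p^(n+1).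
  powerSum-binomial : ∀ n → ∑ (suc n) (λ i → (suc n C i) * powerSum i) ≡ p ^ suc n
  powerSum-binomial n = +-cancelʳ-≡ _ _ _ (begin
      ∑ (suc n) G + powerSum (suc n)
        ≡⟨ cong (∑ (suc n) G +_) (sym (*-identityˡ _)) ⟩
      ∑ (suc n) G + 1 * powerSum (suc n)
        ≡⟨ cong (λ c → ∑ (suc n) G + c * powerSum (suc n)) (sym (nCn≡1 (suc n))) ⟩
      ∑ (suc (suc n)) G
        ≡⟨ ∑-cong (suc (suc n)) (λ i _ → sym (∑-*ˡ p (suc n C i) (λ a → a ^ i))) ⟩
      ∑ (suc (suc n)) (λ i → ∑ p (λ a → (suc n C i) * a ^ i))
        ≡⟨ sym (∑-swap p (suc (suc n)) (λ a i → (suc n C i) * a ^ i)) ⟩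
      ∑ p (λ a → ∑ (suc (suc n)) (λ i → (suc n C i) * a ^ i))
        ≡⟨ ∑-cong p (λ a _ → sym (trans (cong (_^ suc n) (+-comm 1 a)) (binomial-theorem a (suc n)))) ⟩
      ∑ p (λ a → suc a ^ suc n)
        ≡⟨ sym (+-identityʳ _) ⟩
      ∑ p (λ a → suc a ^ suc n) + 0 ^ suc n
        ≡⟨ ∑-telescope p (_^ suc n) ⟩
      powerSum (suc n) + p ^ suc n
        ≡⟨ +-comm (powerSum (suc n)) _ ⟩
      p ^ suc n + powerSum (suc n) ∎)
    where
      open ≡-Reasoning
      G : ℕ → ℕ
      G i = (suc n C i) * powerSum i

  -- In powerSum-binomial the term i = 0 is p, the terms 0 < i < n are divisible by p by
  -- induction, and the term i = n is (n + 1) · powerSum n.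
  p∣powerSum : ∀ n → suc n < p → p ∣ powerSum n
  p∣powerSum = <-rec _ step
    where
      open import Data.Nat.Induction using (<-rec)
      step : ∀ n → (∀ {i} → i < n → suc i < p → p ∣ powerSum i) → suc n < p → p ∣ powerSum n
      step n rec n+1<p = ∣-*-cancelˡ (∤-positive-< (s≤s z≤n) n+1<p) p∣[n+1]Sₙ
        where
          G : ℕ → ℕ
          G i = (suc n C i) * powerSum i
          lower : ∀ i → i < n → p ∣ G i
          lower zero    _   = ∣n⇒∣m*n 1 (subst (p ∣_) (sym (∑-ones p)) ∣-refl)
          lower (suc i) i<n = ∣n⇒∣m*n (suc n C suc i) (rec i<n (<-trans (s≤s i<n) n+1<p))
          p∣[n+1]Sₙ : p ∣ suc n * powerSum n
          p∣[n+1]Sₙ = subst (p ∣_) (cong (_* powerSum n) (suc-C-self n))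
                        (∣m+n∣m⇒∣n (subst (p ∣_) (sym (powerSum-binomial n)) (∣m⇒∣m*n (p ^ n) ∣-refl))
                                    (∣-∑ n lower))

  [2w+1]²+3≡4[w²+w+1] : ∀ w → (2 * w + 1) * (2 * w + 1) + 3 ≡ 4 * (w * w + w + 1)
  [2w+1]²+3≡4[w²+w+1] = solve-∀

  cube-root-of-unity : ∀ ω → p ∣ ω * ω + ω + 1 → ω * (ω * ω) ≈ 1
  cube-root-of-unity ω p∣u = ≈-+-cancelʳ (ω * ω + ω + 1) (begin
      ω * (ω * ω) + (ω * ω + ω + 1)     ≡⟨ identity ω ⟩
      ω * (ω * ω + ω + 1) + 1           ≈⟨ ≈-+ (≈-* {ω} ≈-refl (∣⇒≈0 p∣u)) ≈-refl ⟩
      ω * 0 + 1                         ≡⟨ cong (_+ 1) (*-zeroʳ ω) ⟩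
      1                                 ≈⟨ ≈-+ {1} ≈-refl (∣⇒≈0 p∣u) ⟨
      1 + (ω * ω + ω + 1)               ∎)
    where
      open import Relation.Binary.Reasoning.Setoid ≈-setoid
      identity : ∀ w → w * (w * w) + (w * w + w + 1) ≡ w * (w * w + w + 1) + 1
      identity = solve-∀

  -- ω³ − 1 = (ω − 1)(ω² + ω + 1), written for ω = w + 1 to avoid subtraction.
  nontrivial-cube-root-of-unity : ∀ ω → ω * (ω * ω) ≈ 1 → ¬ ω ≈ 1 → p ∣ ω * ω + ω + 1
  nontrivial-cube-root-of-unity zero    ω³≈1 _    = ⊥-elim (∤-positive-< (s≤s z≤n) 1<p (≈0⇒∣ (≈-sym ω³≈1)))
  nontrivial-cube-root-of-unity (suc w) ω³≈1 ω≉1 = subst (p ∣_) (sym (square-identity w)) (∣-*-cancelˡ p∤w p∣wv)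
    where
      v = w * w + 3 * w + 3
      cube-identity : ∀ w → w * (w * w + 3 * w + 3) + 1 ≡ suc w * (suc w * suc w)
      cube-identity = solve-∀
      square-identity : ∀ w → suc w * suc w + suc w + 1 ≡ w * w + 3 * w + 3
      square-identity = solve-∀
      p∣wv : p ∣ w * v
      p∣wv = ≈0⇒∣ (≈-+-cancelʳ 1 (≈-trans (≈-reflexive (cube-identity w)) ω³≈1))
      p∤w : ¬ p ∣ w
      p∤w p∣w = ω≉1 (≈-trans (≈-reflexive (+-comm 1 w)) (≈-+ (∣⇒≈0 p∣w) ≈-refl))

  module _ (5≤p : 5 ≤ p) where

    p∤3 : ¬ p ∣ 3
    p∤3 = ∤-positive-< (s≤s z≤n) (≤-trans (s≤s (s≤s (s≤s (s≤s z≤n)))) 5≤p)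

    p∤4 : ¬ p ∣ 4
    p∤4 = ∤-positive-< (s≤s z≤n) 5≤p

    2∤p : ¬ 2 ∣ p
    2∤p 2∣p = Prime.notComposite p-prime (composite (≤-trans (s≤s (s≤s (s≤s z≤n))) 5≤p) 2∣p)

    3∤p : ¬ 3 ∣ p
    3∤p 3∣p = Prime.notComposite p-prime (composite (≤-trans (s≤s (s≤s (s≤s (s≤s z≤n)))) 5≤p) 3∣p)

    p%2≡1 : p % 2 ≡ 1
    p%2≡1 with p % 2 in eq | m%n<n p 2
    ... | 0           | _               = ⊥-elim (2∤p (m%n≡0⇒n∣m p 2 eq))
    ... | 1           | _               = refl
    ... | suc (suc _) | s≤s (s≤s ())

    -- ω has order 3; if p − 1 were 3q + 1, Fermat would give 1 ≡ ω^(p − 1) ≡ ω.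
    cube-root-of-unity⇒p%3≡1 : ∀ ω → p ∣ ω * ω + ω + 1 → p % 3 ≡ 1
    cube-root-of-unity⇒p%3≡1 ω p∣u with p % 3 in eq | m%n<n p 3
    ... | 0 | _ = ⊥-elim (3∤p (m%n≡0⇒n∣m p 3 eq))
    ... | 1 | _ = refl
    ... | 2 | _ = ⊥-elim (ω≉1 (≈-trans (≈-sym ω^p₀≈ω) (fermat-unit p∤ω)))
      where
        ω³≈1 : ω * (ω * ω) ≈ 1
        ω³≈1 = cube-root-of-unity ω p∣u
        ω^[3k]≈1 : ∀ k → ω ^ (k * 3) ≈ 1
        ω^[3k]≈1 zero    = ≈-refl
        ω^[3k]≈1 (suc k) = ≈-trans (≈-reflexive (regroup ω (ω ^ (k * 3)))) (≈-* ω³≈1 (ω^[3k]≈1 k))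
          where
            regroup : ∀ w x → w * (w * (w * x)) ≡ w * (w * w) * x
            regroup = solve-∀
        p₀≡1+3q : p₀ ≡ suc (p / 3 * 3)
        p₀≡1+3q = suc-injective (trans (m≡m%n+[m/n]*n p 3) (cong (_+ p / 3 * 3) eq))
        ω^p₀≈ω : ω ^ p₀ ≈ ω
        ω^p₀≈ω = subst (λ e → ω ^ e ≈ ω) (sym p₀≡1+3q)
                   (≈-trans (≈-* {ω} ≈-refl (ω^[3k]≈1 (p / 3))) (≈-reflexive (*-identityʳ ω)))
        u≈1 : p ∣ ω → ω * ω + ω + 1 ≈ 1
        u≈1 p∣ω = ≈-+ {ω * ω + ω} {0} (≈-+ {ω * ω} {0} (≈-* (∣⇒≈0 p∣ω) ≈-refl) (∣⇒≈0 p∣ω)) ≈-refl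
        p∤ω : ¬ p ∣ ω
        p∤ω p∣ω = ∤-positive-< (s≤s z≤n) 1<p (≈0⇒∣ (≈-trans (≈-sym (u≈1 p∣ω)) (∣⇒≈0 p∣u)))
        ω≉1 : ¬ ω ≈ 1
        ω≉1 ω≈1 = p∤3 (≈0⇒∣ (≈-trans (≈-sym (≈-+ {ω * ω + ω} (≈-+ (≈-* ω≈1 ω≈1) ω≈1) ≈-refl)) (∣⇒≈0 p∣u)))
    ... | suc (suc (suc _)) | s≤s (s≤s (s≤s ()))

    -3-square⇒p%3≡1 : ∀ y → p ∣ y * y + 3 → p % 3 ≡ 1
    -3-square⇒p%3≡1 y p∣y²+3 = cube-root-of-unity⇒p%3≡1 ω (∣-*-cancelˡ p∤4 p∣4u)
      where
        h = p / 2
        p₀≡2h : p₀ ≡ 2 * h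
        p₀≡2h = suc-injective (trans (m≡m%n+[m/n]*n p 2) (cong₂ _+_ p%2≡1 (*-comm h 2)))
        -- ω is (y − 1)/2 modulo p, with 1/2 represented by h + 1.
        ω = (y + p₀) * (h + 1)
        2ω+1≈y : 2 * ω + 1 ≈ y
        2ω+1≈y = ≈-trans (≈-reflexive (trans (cong (λ e → 2 * ((y + e) * (h + 1)) + 1) p₀≡2h) (identity y h)))
                   (+-∣-≈ y (∣n⇒∣m*n (y + 2 * h + 1) (subst (p ∣_) (trans (cong suc p₀≡2h) (+-comm 1 (2 * h))) ∣-refl)))
          where
            identity : ∀ y h → 2 * ((y + 2 * h) * (h + 1)) + 1 ≡ y + (y + 2 * h + 1) * (2 * h + 1)
            identity = solve-∀
        p∣4u : p ∣ 4 * (ω * ω + ω + 1)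
        p∣4u = subst (p ∣_) ([2w+1]²+3≡4[w²+w+1] ω)
                 (≈0⇒∣ (≈-trans (≈-+ (≈-* 2ω+1≈y 2ω+1≈y) ≈-refl) (∣⇒≈0 p∣y²+3)))

    ∃-nontrivial-cube-root-of-unity : p % 3 ≡ 1 → ∃ λ ω → ω * (ω * ω) ≈ 1 × ¬ ω ≈ 1
    ∃-nontrivial-cube-root-of-unity p%3≡1 = search (anyUpTo? (λ a → ¬? (suc a ^ q ≈? 1)) p₀)
      where
        q = p / 3
        p₀≡q*3 : p₀ ≡ q * 3
        p₀≡q*3 = suc-injective (trans (m≡m%n+[m/n]*n p 3) (cong (_+ q * 3) p%3≡1))
        1≤q : 1 ≤ q
        1≤q with q | p₀≡q*3
        ... | zero  | p₀≡0 = ⊥-elim (<⇒≱ 1<p (≤-reflexive (cong suc p₀≡0)))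
        ... | suc _ | _    = s≤s z≤n
        0^q≡0 : 0 ^ q ≡ 0
        0^q≡0 with q | 1≤q
        ... | suc _ | _ = refl
        q<p₀ : q < p₀
        q<p₀ = subst (q <_) (sym p₀≡q*3) (m<m*n q 3 {{>-nonZero 1≤q}} (s≤s (s≤s z≤n)))
        -- the powers (a + 1)^q sum to p₀ modulo p if they are all 1, but p ∣ powerSum q
        search : Dec (∃ λ a → a < p₀ × ¬ suc a ^ q ≈ 1) → ∃ λ ω → ω * (ω * ω) ≈ 1 × ¬ ω ≈ 1
        search (yes (a , a<p₀ , ω≉1)) = suc a ^ q , ω³≈1 , ω≉1
          where
            ω = suc a ^ q
            ω³≈1 : ω * (ω * ω) ≈ 1
            ω³≈1 = ≈-trans (≈-reflexive (trans (cong (λ x → ω * (ω * x)) (sym (*-identityʳ ω)))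
                                               (trans (^-*-assoc (suc a) q 3) (cong (suc a ^_) (sym p₀≡q*3)))))
                           (fermat-unit (∤-positive-< (s≤s z≤n) (s≤s a<p₀)))
        search (no ∄a) = ⊥-elim (∤-positive-< (<-≤-trans (s≤s z≤n) q<p₀) ≤-refl (≈0⇒∣ (begin
            p₀                                ≡⟨ sym (∑-ones p₀) ⟩
            ∑ p₀ (λ _ → 1)                    ≈⟨ ≈-∑ p₀ all-one ⟨
            ∑ p₀ (λ a → suc a ^ q)            ≡⟨ cong (_+ ∑ p₀ (λ a → suc a ^ q)) 0^q≡0 ⟨
            0 ^ q + ∑ p₀ (λ a → suc a ^ q)    ≡⟨ sym (∑-unconsˡ p₀ (_^ q)) ⟩
            powerSum q                        ≈⟨ ∣⇒≈0 (p∣powerSum q (s≤s (<-≤-trans q<p₀ ≤-refl))) ⟩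
            0                                 ∎)))
          where
            open import Relation.Binary.Reasoning.Setoid ≈-setoid
            all-one : ∀ a → a < p₀ → suc a ^ q ≈ 1
            all-one a a<p₀ = decidable-stable (suc a ^ q ≈? 1) (λ ω≉1 → ∄a (a , a<p₀ , ω≉1))

    p%3≡1⇒-3-square : p % 3 ≡ 1 → ∃ λ y → p ∣ y * y + 3
    p%3≡1⇒-3-square p%3≡1 with ∃-nontrivial-cube-root-of-unity p%3≡1
    ... | ω , ω³≈1 , ω≉1 = 2 * ω + 1 , subst (p ∣_) (sym ([2w+1]²+3≡4[w²+w+1] ω))
                                         (∣n⇒∣m*n 4 (nontrivial-cube-root-of-unity ω ω³≈1 ω≉1))

module AnyUpTo where
  open import Data.Bool as Bool using (Bool)
  open import Data.Bool.ListAction using (any)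
  open import Data.List using (upTo)
  open import Data.List.Relation.Unary.Any.Properties using (any⁺; any⁻)
  open import Data.List.Membership.Propositional using (find; lose)
  open import Data.List.Membership.Propositional.Properties using (∈-upTo⁺; ∈-upTo⁻)
  open import Data.Product using (∃; _×_; _,_)

  any-upTo⁺ : ∀ (b : ℕ → Bool) {n i} → i < n → Bool.T (b i) → Bool.T (any b (upTo n))
  any-upTo⁺ b i<n bi = any⁺ b (lose (∈-upTo⁺ i<n) bi)

  any-upTo⁻ : ∀ (b : ℕ → Bool) n → Bool.T (any b (upTo n)) → ∃ λ i → i < n × Bool.T (b i)
  any-upTo⁻ b n t with find (any⁻ b (upTo n) t)
  ... | i , i∈ , bi = i , ∈-upTo⁻ i∈ , bi

module Legendre (q : ℕ) (p-prime : Prime (3 ℕ.+ q)) where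
  open import Data.Nat
  open import Data.Nat.Properties
  open import Data.Nat.DivMod
  open import Data.Nat.Divisibility
  open import Data.Integer as ℤ using (-[1+_]; 0ℤ; 1ℤ; -1ℤ)
  open import Data.Bool as Bool using (Bool; true; false; if_then_else_)
  open import Data.Bool.ListAction using (any)
  open import Data.List using (upTo)
  open import Data.Product using (∃; _,_; uncurry)
  open import Data.Empty using (⊥-elim)
  open import Relation.Nullary using (¬_)
  open import Relation.Binary.PropositionalEquality using (_≢_)
  open Eq
  open import Data.Bool.Properties using (T-≡)
  open import Function.Bundles using (Equivalence)
  open ModPrime (2 + q) p-prime
  open AnyUpTo

  private
    IsRootMod : ℕ → ℕ → Bool
    IsRootMod r x = x * x % p ≡ᵇ r

  kronP-+-∣ : ∀ {a} → p ∣ a → kronP (ℤ.+ a) p ≡ 0ℤ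
  kronP-+-∣ {a} p∣a rewrite n∣m⇒m%n≡0 a p p∣a = refl

  -[1+]%ℕp-∣ : ∀ {t} → p ∣ suc t → -[1+ t ] ℤ.%ℕ p ≡ 0
  -[1+]%ℕp-∣ {t} p∣ with suc t % p | n∣m⇒m%n≡0 (suc t) p p∣
  ... | .0 | refl = refl

  kronP--[1+]-∣ : ∀ {t} → p ∣ suc t → kronP -[1+ t ] p ≡ 0ℤ
  kronP--[1+]-∣ {t} p∣ rewrite -[1+]%ℕp-∣ p∣ = refl

  kronP-square : ∀ {e} → ¬ p ∣ e → kronP (ℤ.+ (e * e)) p ≡ 1ℤ
  kronP-square {e} p∤e with e * e % p ≡ᵇ 0 in e²%p≡ᵇ0
  ... | true  = ⊥-elim (p∤e (∣-*-cancelˡ p∤e (m%n≡0⇒n∣m (e * e) p (≡ᵇ⇒≡ _ 0 (Eq.subst Bool.T (sym e²%p≡ᵇ0) _)))))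
  ... | false rewrite Equivalence.to T-≡ (any-upTo⁺ (IsRootMod (e * e % p)) (m%n<n e p) (≡⇒≡ᵇ _ _ (sym (%-distribˡ-* e e p)))) = refl

  -[1+]%ℕp-∤ : ∀ {t} → ¬ p ∣ suc t → -[1+ t ] ℤ.%ℕ p ≡ p ∸ suc t % p
  -[1+]%ℕp-∤ {t} p∤ with suc t % p in eq
  ... | zero  = ⊥-elim (p∤ (m%n≡0⇒n∣m (suc t) p eq))
  ... | suc _ = refl

  -- X % p + N % p is a positive multiple of p below 2p, hence p.
  ∣+⇒%≡∸% : ∀ X N → ¬ p ∣ N → p ∣ X + N → X % p ≡ p ∸ N % p
  ∣+⇒%≡∸% X N p∤N p∣X+N = trans (sym (m+n∸n≡m (X % p) (N % p))) (cong (_∸ N % p) (only-multiple (X % p + N % p) p∣sum 0<sum sum<2p))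
    where
      only-multiple : ∀ v → p ∣ v → 0 < v → v < 2 * p → v ≡ p
      only-multiple v (divides zero refl) () _
      only-multiple v (divides 1 refl) _ _ = +-identityʳ p
      only-multiple v (divides (suc (suc c)) refl) _ v<2p =
        ⊥-elim (<⇒≱ v<2p (+-monoʳ-≤ p (subst (_≤ p + c * p) (sym (+-identityʳ p)) (m≤m+n p (c * p)))))
      p∣sum : p ∣ X % p + N % p
      p∣sum = ≈0⇒∣ (≈-trans (≈-+ (%-≈ X) (%-≈ N)) (∣⇒≈0 p∣X+N))
      0<sum : 0 < X % p + N % p
      0<sum with N % p in eq
      ... | zero  = ⊥-elim (p∤N (m%n≡0⇒n∣m N p eq))
      ... | suc _ = <-≤-trans (s≤s z≤n) (m≤n+m _ (X % p))
      sum<2p : X % p + N % p < 2 * p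
      sum<2p = subst (X % p + N % p <_) (cong (p +_) (sym (+-identityʳ p))) (+-mono-<-≤ (m%n<n X p) (m%n≤n N p))

  %≡∸%⇒∣+ : ∀ X N → X % p ≡ p ∸ N % p → p ∣ X + N
  %≡∸%⇒∣+ X N eq = ≈0⇒∣ (≈-trans (≈-+ (≈-sym (%-≈ X)) (≈-sym (%-≈ N)))
                                 (≈-trans (≈-reflexive (trans (cong (_+ N % p) eq) (m∸n+n≡m (m%n≤n N p)))) (∣⇒≈0 ∣-refl)))

  kronP--[1+]-∤ : ∀ {t} → ¬ p ∣ suc t →
                  kronP -[1+ t ] p ≡ (if any (IsRootMod (p ∸ suc t % p)) (upTo p) then 1ℤ else -1ℤ)
  kronP--[1+]-∤ {t} p∤ rewrite -[1+]%ℕp-∤ p∤ with p ∸ suc t % p ≡ᵇ 0 in r≡ᵇ0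
  ... | false = refl
  ... | true  = ⊥-elim (<⇒≱ (m%n<n (suc t) p) (m∸n≡0⇒m≤n (≡ᵇ⇒≡ _ 0 (subst Bool.T (sym r≡ᵇ0) _))))

  kronP-negative-residue : ∀ {t} → ¬ p ∣ suc t → (∃ λ x → p ∣ x * x + suc t) → kronP -[1+ t ] p ≡ 1ℤ
  kronP-negative-residue {t} p∤ (x , p∣x²+N) rewrite kronP--[1+]-∤ p∤ =
    cong (λ b → if b then 1ℤ else -1ℤ) (Equivalence.to T-≡ (any-upTo⁺ (IsRootMod (p ∸ suc t % p)) (m%n<n x p) root))
    where
      root : Bool.T (IsRootMod (p ∸ suc t % p) (x % p))
      root = ≡⇒≡ᵇ _ _ (trans (sym (%-distribˡ-* x x p)) (∣+⇒%≡∸% (x * x) (suc t) p∤ p∣x²+N))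

  kronP-negative-nonresidue : ∀ {t} → ¬ p ∣ suc t → ¬ (∃ λ x → p ∣ x * x + suc t) → kronP -[1+ t ] p ≡ -1ℤ
  kronP-negative-nonresidue {t} p∤ ∄x rewrite kronP--[1+]-∤ p∤ with any (IsRootMod (p ∸ suc t % p)) (upTo p) in found
  ... | false = refl
  ... | true with any-upTo⁻ (IsRootMod (p ∸ suc t % p)) p (subst Bool.T (sym found) _)
  ...   | x , _ , root = ⊥-elim (∄x (x , %≡∸%⇒∣+ (x * x) (suc t) (≡ᵇ⇒≡ _ _ root)))

  module _ (5≤p : 5 ≤ p) where

    p∤3e² : ∀ {e} → ¬ p ∣ e → ¬ p ∣ 3 * (e * e)
    p∤3e² p∤e p∣3e² = p∤e (∣-*-cancelˡ p∤e (∣-*-cancelˡ (p∤3 5≤p) p∣3e²))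

    -- multiply the root by e⁻¹ = e^(p − 2)
    -3e²-residue⇒-3-square : ∀ {e} → ¬ p ∣ e → (∃ λ x → p ∣ x * x + 3 * (e * e)) → ∃ λ y → p ∣ y * y + 3
    -3e²-residue⇒-3-square {e} p∤e (x , p∣) = x * e′ , ≈0⇒∣ (begin
        x * e′ * (x * e′) + 3                        ≈⟨ ≈-+ {x * e′ * (x * e′)} ≈-refl (≈-* {3} ≈-refl (≈-* ee′≈1 ee′≈1)) ⟨
        x * e′ * (x * e′) + 3 * (e * e′ * (e * e′))  ≡⟨ identity e e′ x ⟨
        e′ * e′ * (x * x + 3 * (e * e))              ≈⟨ ≈-* {e′ * e′} ≈-refl (∣⇒≈0 p∣) ⟩
        e′ * e′ * 0                                  ≡⟨ *-zeroʳ (e′ * e′) ⟩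
        0                                            ∎)
      where
        open import Relation.Binary.Reasoning.Setoid ≈-setoid
        e′ = e ^ suc q
        ee′≈1 : e * e′ ≈ 1
        ee′≈1 = fermat-unit p∤e
        identity : ∀ e e′ x → e′ * e′ * (x * x + 3 * (e * e)) ≡ x * e′ * (x * e′) + 3 * (e * e′ * (e * e′))
        identity = solve-∀

    -3-square⇒-3e²-residue : ∀ e → (∃ λ y → p ∣ y * y + 3) → ∃ λ x → p ∣ x * x + 3 * (e * e)
    -3-square⇒-3e²-residue e (y , p∣) = y * e , subst (p ∣_) (identity y e) (∣n⇒∣m*n (e * e) p∣)
      where
        identity : ∀ y e → e * e * (y * y + 3) ≡ y * e * (y * e) + 3 * (e * e)
        identity = solve-∀

    -- (−3e² / p) = (−3 / p) = (p / 3): −3 is a square modulo p iff p ≡ 1 (mod 3).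
    kronP--3e² : ∀ {e} → ¬ p ∣ e → kronP (ℤ.- (ℤ.+ (3 * (e * e)))) p ≡ kronP (ℤ.+ p) 3
    kronP--3e² {zero}  p∤e = ⊥-elim (p∤e (p ∣0))
    kronP--3e² {suc e} p∤e with p % 3 in p%3 | m%n<n p 3
    ... | 0 | _ = ⊥-elim (3∤p 5≤p (m%n≡0⇒n∣m p 3 p%3))
    ... | 1 | _ = kronP-negative-residue (p∤3e² p∤e) (-3-square⇒-3e²-residue (suc e) (p%3≡1⇒-3-square 5≤p p%3))
    ... | 2 | _ = kronP-negative-nonresidue (p∤3e² p∤e) λ residue →
                    1≢2 (trans (sym (uncurry (-3-square⇒p%3≡1 5≤p) (-3e²-residue⇒-3-square p∤e residue))) p%3)
      where
        1≢2 : 1 ≢ 2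
        1≢2 ()
    ... | suc (suc (suc _)) | s≤s (s≤s (s≤s ()))

module KroneckerAtTwo where
  open import Data.Nat
  open import Data.Nat.Properties
  open import Data.Nat.DivMod
  open import Data.Nat.Divisibility
  open import Data.Integer as ℤ using (-[1+_]; 0ℤ; 1ℤ; -1ℤ)
  open import Data.Sum using (_⊎_; inj₁; inj₂)
  open import Data.Product using (_×_; _,_; proj₁; proj₂)
  open import Data.Empty using (⊥-elim)
  open import Relation.Nullary using (¬_)
  open Eq

  private
    %8%8 : ∀ a → a % 8 % 8 ≡ a % 8
    %8%8 a = m%n%n≡m%n a 8

    kronP-+-%8 : ∀ a → kronP (ℤ.+ a) 2 ≡ kronP (ℤ.+ (a % 8)) 2
    kronP-+-%8 a rewrite %8%8 a = refl

    kronP--[1+]-%8≡0 : ∀ t → suc t % 8 ≡ 0 → kronP -[1+ t ] 2 ≡ 0ℤ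
    kronP--[1+]-%8≡0 t eq with suc t % 8
    kronP--[1+]-%8≡0 t refl | .0 = refl

    kronP--[1+]-%8≡3 : ∀ t → suc t % 8 ≡ 3 → kronP -[1+ t ] 2 ≡ -1ℤ
    kronP--[1+]-%8≡3 t eq with suc t % 8
    kronP--[1+]-%8≡3 t refl | .3 = refl

    kronP--[1+]-%8≡4 : ∀ t → suc t % 8 ≡ 4 → kronP -[1+ t ] 2 ≡ 0ℤ
    kronP--[1+]-%8≡4 t eq with suc t % 8
    kronP--[1+]-%8≡4 t refl | .4 = refl

    even-residue-table : ∀ r → r < 8 → r % 2 ≡ 0 →
                 kronP (ℤ.+ (r * r)) 2 ≡ 0ℤ × (3 * (r * r) % 8 ≡ 0 ⊎ 3 * (r * r) % 8 ≡ 4)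
    even-residue-table 0 _ _ = refl , inj₁ refl
    even-residue-table 2 _ _ = refl , inj₂ refl
    even-residue-table 4 _ _ = refl , inj₁ refl
    even-residue-table 6 _ _ = refl , inj₂ refl
    even-residue-table 1 _ ()
    even-residue-table 3 _ ()
    even-residue-table 5 _ ()
    even-residue-table 7 _ ()
    even-residue-table (suc (suc (suc (suc (suc (suc (suc (suc _)))))))) (s≤s (s≤s (s≤s (s≤s (s≤s (s≤s (s≤s (s≤s ())))))))) _

    odd-residue-table : ∀ r → r < 8 → r % 2 ≡ 1 → kronP (ℤ.+ (r * r)) 2 ≡ 1ℤ × 3 * (r * r) % 8 ≡ 3
    odd-residue-table 1 _ _ = refl , refl
    odd-residue-table 3 _ _ = refl , refl
    odd-residue-table 5 _ _ = refl , refl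
    odd-residue-table 7 _ _ = refl , refl
    odd-residue-table 0 _ ()
    odd-residue-table 2 _ ()
    odd-residue-table 4 _ ()
    odd-residue-table 6 _ ()
    odd-residue-table (suc (suc (suc (suc (suc (suc (suc (suc _)))))))) (s≤s (s≤s (s≤s (s≤s (s≤s (s≤s (s≤s (s≤s ())))))))) _

    e²%8 : ∀ e → e * e % 8 ≡ (e % 8) * (e % 8) % 8
    e²%8 e = %-distribˡ-* e e 8

    3e²%8 : ∀ e → 3 * (e * e) % 8 ≡ 3 * ((e % 8) * (e % 8)) % 8
    3e²%8 e = trans (%-distribˡ-* 3 (e * e) 8) (trans (cong (λ x → 3 * x % 8) (e²%8 e)) (sym (%-distribˡ-* 3 ((e % 8) * (e % 8)) 8)))

    kronP-e² : ∀ e → kronP (ℤ.+ (e * e)) 2 ≡ kronP (ℤ.+ ((e % 8) * (e % 8))) 2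
    kronP-e² e = trans (kronP-+-%8 (e * e)) (trans (cong (λ x → kronP (ℤ.+ x) 2) (e²%8 e)) (sym (kronP-+-%8 ((e % 8) * (e % 8)))))

    %8%2 : ∀ e → e % 8 % 2 ≡ e % 2
    %8%2 e = m∣n⇒o%n%m≡o%m 2 8 e (divides 4 refl)

    %2≡1 : ∀ {e} → ¬ 2 ∣ e → e % 2 ≡ 1
    %2≡1 {e} 2∤e with e % 2 in eq | m%n<n e 2
    ... | 0           | _ = ⊥-elim (2∤e (m%n≡0⇒n∣m e 2 eq))
    ... | 1           | _ = refl
    ... | suc (suc _) | s≤s (s≤s ())

  kronP-2-e²-∣ : ∀ {e} → 2 ∣ e → kronP (ℤ.+ (e * e)) 2 ≡ 0ℤ
  kronP-2-e²-∣ {e} 2∣e =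
    trans (kronP-e² e) (proj₁ (even-residue-table (e % 8) (m%n<n e 8) (trans (%8%2 e) (n∣m⇒m%n≡0 e 2 2∣e))))

  kronP-2-e²-∤ : ∀ {e} → ¬ 2 ∣ e → kronP (ℤ.+ (e * e)) 2 ≡ 1ℤ
  kronP-2-e²-∤ {e} 2∤e = trans (kronP-e² e) (proj₁ (odd-residue-table (e % 8) (m%n<n e 8) (trans (%8%2 e) (%2≡1 2∤e))))

  kronP-2--3e²-∣ : ∀ {e} → 2 ∣ e → kronP (ℤ.- (ℤ.+ (3 * (e * e)))) 2 ≡ 0ℤ
  kronP-2--3e²-∣ {zero}  _   = refl
  kronP-2--3e²-∣ {suc e} 2∣e with proj₂ (even-residue-table (suc e % 8) (m%n<n (suc e) 8) (trans (%8%2 (suc e)) (n∣m⇒m%n≡0 (suc e) 2 2∣e)))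
  ... | inj₁ ≡0 = kronP--[1+]-%8≡0 (pred (3 * (suc e * suc e))) (trans (3e²%8 (suc e)) ≡0)
  ... | inj₂ ≡4 = kronP--[1+]-%8≡4 (pred (3 * (suc e * suc e))) (trans (3e²%8 (suc e)) ≡4)

  kronP-2--3e²-∤ : ∀ {e} → ¬ 2 ∣ e → kronP (ℤ.- (ℤ.+ (3 * (e * e)))) 2 ≡ -1ℤ
  kronP-2--3e²-∤ {zero}  2∤e = ⊥-elim (2∤e (2 ∣0))
  kronP-2--3e²-∤ {suc e} 2∤e =
    kronP--[1+]-%8≡3 (pred (3 * (suc e * suc e))) (trans (3e²%8 (suc e)) (proj₂ (odd-residue-table (suc e % 8) (m%n<n (suc e) 8) (trans (%8%2 (suc e)) (%2≡1 2∤e)))))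

module KroneckerOnDSquares where
  open import Data.Nat
  open import Data.Nat.Properties
  open import Data.Nat.Divisibility
  open import Data.Nat.Primality using (¬prime[0]; ¬prime[1]; prime⇒¬composite; composite[4])
  open import Data.Integer as ℤ using (0ℤ)
  import Data.Integer.Properties as ℤP
  open import Data.Bool using (true; false)
  open import Data.Empty using (⊥-elim)
  open import Relation.Nullary using (¬_)
  open Eq
  open KroneckerAtTwo

  chiP-D-square-∣ : ∀ k {p} → Prime p → ∀ {e} → p ∣ e → chiP k p (ℤ.+ (absD k * (e * e))) ≡ 0ℤ
  chiP-D-square-∣ k {p} p-prime {e} p∣e with isEven k
  chiP-D-square-∣ k {0} p-prime p∣e | _ = ⊥-elim (¬prime[0] p-prime)
  chiP-D-square-∣ k {1} p-prime p∣e | _ = ⊥-elim (¬prime[1] p-prime)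
  chiP-D-square-∣ k {2} p-prime {e} p∣e | true = trans (cong (λ x → kronP (ℤ.+ x) 2) (*-identityˡ (e * e))) (kronP-2-e²-∣ p∣e)
  chiP-D-square-∣ k {2} p-prime p∣e | false = kronP-2--3e²-∣ p∣e
  chiP-D-square-∣ k {suc (suc (suc q))} p-prime {e} p∣e | true =
    Legendre.kronP-+-∣ q p-prime (∣n⇒∣m*n 1 (∣m⇒∣m*n e p∣e))
  chiP-D-square-∣ k {suc (suc (suc q))} p-prime {zero}  p∣e | false = refl
  chiP-D-square-∣ k {suc (suc (suc q))} p-prime {suc e} p∣e | false =
    Legendre.kronP--[1+]-∣ q p-prime (∣n⇒∣m*n 3 (∣m⇒∣m*n (suc e) p∣e))

  chiP-D-square-∤ : ∀ k {p} → Prime p → ∀ {e} → ¬ p ∣ e → chiP k p (ℤ.+ (absD k * (e * e))) ≡ kronD k p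
  chiP-D-square-∤ k {p} p-prime {e} p∤e with isEven k
  chiP-D-square-∤ k {0} p-prime p∤e | _ = ⊥-elim (¬prime[0] p-prime)
  chiP-D-square-∤ k {1} p-prime p∤e | _ = ⊥-elim (¬prime[1] p-prime)
  chiP-D-square-∤ k {2} p-prime {e} p∤e | true = trans (cong (λ x → kronP (ℤ.+ x) 2) (*-identityˡ (e * e))) (kronP-2-e²-∤ p∤e)
  chiP-D-square-∤ k {2} p-prime p∤e | false = kronP-2--3e²-∤ p∤e
  chiP-D-square-∤ k {suc (suc (suc q))} p-prime {e} p∤e | true =
    trans (cong (λ x → kronP (ℤ.+ x) (3 + q)) (*-identityˡ (e * e))) (Legendre.kronP-square q p-prime p∤e)
  chiP-D-square-∤ k {3} p-prime {zero}  p∤e | false = ⊥-elim (p∤e (3 ∣0))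
  chiP-D-square-∤ k {3} p-prime {suc e} p∤e | false = Legendre.kronP--[1+]-∣ 0 prime[3] (m∣m*n (suc e * suc e))
  chiP-D-square-∤ k {4} p-prime p∤e | false = ⊥-elim (prime⇒¬composite p-prime composite[4])
  chiP-D-square-∤ k {suc (suc (suc (suc (suc r))))} p-prime p∤e | false =
    trans (Legendre.kronP--3e² (2 + r) p-prime (s≤s (s≤s (s≤s (s≤s (s≤s z≤n))))) p∤e) (sym (ℤP.*-identityˡ _))

module KroneckerMultiplicative where
  open import Data.Nat
  open import Data.Nat.Properties
  open import Data.Nat.DivMod
  import Data.Integer as ℤ
  import Data.Integer.Properties as ℤP
  open import Data.Bool using (true; false)
  open Eq

  private
    %3%3 : ∀ a → a % 3 % 3 ≡ a % 3
    %3%3 a = m%n%n≡m%n a 3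

    kronP-3-%3 : ∀ a → kronP (ℤ.+ a) 3 ≡ kronP (ℤ.+ (a % 3)) 3
    kronP-3-%3 a rewrite %3%3 a = refl

    table : ∀ r s → r < 3 → s < 3 → kronP (ℤ.+ (r * s % 3)) 3 ≡ kronP (ℤ.+ r) 3 ℤ.* kronP (ℤ.+ s) 3
    table 0 0 _ _ = refl
    table 0 1 _ _ = refl
    table 0 2 _ _ = refl
    table 1 0 _ _ = refl
    table 1 1 _ _ = refl
    table 1 2 _ _ = refl
    table 2 0 _ _ = refl
    table 2 1 _ _ = refl
    table 2 2 _ _ = refl
    table (suc (suc (suc _))) _ (s≤s (s≤s (s≤s ()))) _
    table 0 (suc (suc (suc _))) _ (s≤s (s≤s (s≤s ())))
    table 1 (suc (suc (suc _))) _ (s≤s (s≤s (s≤s ())))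
    table 2 (suc (suc (suc _))) _ (s≤s (s≤s (s≤s ())))

  kronP-3-* : ∀ a b → kronP (ℤ.+ (a * b)) 3 ≡ kronP (ℤ.+ a) 3 ℤ.* kronP (ℤ.+ b) 3
  kronP-3-* a b = begin
    kronP (ℤ.+ (a * b)) 3                                 ≡⟨ kronP-3-%3 (a * b) ⟩
    kronP (ℤ.+ (a * b % 3)) 3                             ≡⟨ cong (λ x → kronP (ℤ.+ x) 3) (%-distribˡ-* a b 3) ⟩
    kronP (ℤ.+ (a % 3 * (b % 3) % 3)) 3                   ≡⟨ table (a % 3) (b % 3) (m%n<n a 3) (m%n<n b 3) ⟩
    kronP (ℤ.+ (a % 3)) 3 ℤ.* kronP (ℤ.+ (b % 3)) 3       ≡⟨ cong₂ ℤ._*_ (kronP-3-%3 a) (kronP-3-%3 b) ⟨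
    kronP (ℤ.+ a) 3 ℤ.* kronP (ℤ.+ b) 3                   ∎
    where open ≡-Reasoning

  kronD-* : ∀ k a b → kronD k (a * b) ≡ kronD k a ℤ.* kronD k b
  kronD-* k a b with isEven k
  ... | true  = refl
  ... | false = begin
    ℤ.1ℤ ℤ.* kronP (ℤ.+ (a * b)) 3                                    ≡⟨ ℤP.*-identityˡ (kronP (ℤ.+ (a * b)) 3) ⟩
    kronP (ℤ.+ (a * b)) 3                                              ≡⟨ kronP-3-* a b ⟩
    kronP (ℤ.+ a) 3 ℤ.* kronP (ℤ.+ b) 3                                ≡⟨ cong₂ ℤ._*_ (ℤP.*-identityˡ (kronP (ℤ.+ a) 3)) (ℤP.*-identityˡ (kronP (ℤ.+ b) 3)) ⟨
    (ℤ.1ℤ ℤ.* kronP (ℤ.+ a) 3) ℤ.* (ℤ.1ℤ ℤ.* kronP (ℤ.+ b) 3)          ∎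
    where open ≡-Reasoning

module Embedding {c ℓ : Level} (R : CommutativeRing c ℓ) where
  open CommutativeRing R
  open import Data.Integer as ℤ using (-[1+_])
  open import Data.Sign as Sign using (Sign)
  open import Algebra.Properties.Ring ring using (-‿distribˡ-*; -1*x≈-x)
  open import Algebra.Properties.AbelianGroup +-abelianGroup using (⁻¹-involutive)
  open import Algebra.Properties.CommutativeSemigroup *-commutativeSemigroup using (interchange)
  open import Relation.Binary.Reasoning.Setoid setoid

  ιℕ-+ : ∀ m n → ιℕ R (m ℕ.+ n) ≈ ιℕ R m + ιℕ R n
  ιℕ-+ zero    n = sym (+-identityˡ _)
  ιℕ-+ (suc m) n = trans (+-cong refl (ιℕ-+ m n)) (sym (+-assoc 1# _ _))

  ιℕ-* : ∀ m n → ιℕ R (m ℕ.* n) ≈ ιℕ R m * ιℕ R n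
  ιℕ-* zero    n = sym (zeroˡ _)
  ιℕ-* (suc m) n = begin
    ιℕ R (n ℕ.+ m ℕ.* n)             ≈⟨ ιℕ-+ n (m ℕ.* n) ⟩
    ιℕ R n + ιℕ R (m ℕ.* n)          ≈⟨ +-cong (sym (*-identityˡ _)) (ιℕ-* m n) ⟩
    1# * ιℕ R n + ιℕ R m * ιℕ R n    ≈⟨ distribʳ (ιℕ R n) 1# (ιℕ R m) ⟨
    (1# + ιℕ R m) * ιℕ R n           ∎

  private
    σ : Sign → Carrier
    σ Sign.+ = 1#
    σ Sign.- = - 1#

    σ-* : ∀ s t → σ (s Sign.* t) ≈ σ s * σ t
    σ-* Sign.+ t        = sym (*-identityˡ _)
    σ-* Sign.- Sign.+   = sym (*-identityʳ _)
    σ-* Sign.- Sign.-   = sym (trans (sym (-‿distribˡ-* 1# (- 1#))) (trans (-‿cong (*-identityˡ (- 1#))) (⁻¹-involutive 1#)))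

    ι-◃ : ∀ s n → ι R (s ℤ.◃ n) ≈ σ s * ιℕ R n
    ι-◃ s        zero    = sym (zeroʳ (σ s))
    ι-◃ Sign.+   (suc n) = sym (*-identityˡ _)
    ι-◃ Sign.-   (suc n) = sym (-1*x≈-x _)

    ι-sign-abs : ∀ x → ι R x ≈ σ (ℤ.sign x) * ιℕ R ℤ.∣ x ∣
    ι-sign-abs (ℤ.+ n)  = sym (*-identityˡ _)
    ι-sign-abs -[1+ n ] = sym (-1*x≈-x _)

  ι-* : ∀ x y → ι R (x ℤ.* y) ≈ ι R x * ι R y
  ι-* x y = begin
    ι R (x ℤ.* y)                                                  ≈⟨ ι-◃ (ℤ.sign x Sign.* ℤ.sign y) (ℤ.∣ x ∣ ℕ.* ℤ.∣ y ∣) ⟩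
    σ (ℤ.sign x Sign.* ℤ.sign y) * ιℕ R (ℤ.∣ x ∣ ℕ.* ℤ.∣ y ∣)      ≈⟨ *-cong (σ-* (ℤ.sign x) (ℤ.sign y)) (ιℕ-* ℤ.∣ x ∣ ℤ.∣ y ∣) ⟩
    (σ (ℤ.sign x) * σ (ℤ.sign y)) * (ιℕ R ℤ.∣ x ∣ * ιℕ R ℤ.∣ y ∣)  ≈⟨ interchange _ _ _ _ ⟩
    (σ (ℤ.sign x) * ιℕ R ℤ.∣ x ∣) * (σ (ℤ.sign y) * ιℕ R ℤ.∣ y ∣)  ≈⟨ *-cong (ι-sign-abs x) (ι-sign-abs y) ⟨
    ι R x * ι R y                                                  ∎

module DivisorSum {c ℓ : Level} (R : CommutativeRing c ℓ) where
  open CommutativeRing R hiding (zero)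
  open FiniteSum commutativeSemiring
  open import Data.Nat.DivMod using (m*n/n≡m; m/n*n≡m)
  open import Data.Nat.Divisibility using (_∣_; _∣?_; divides; ∣⇒≤; ∣-trans; *-cancelˡ-∣)
  open import Data.Bool using (if_then_else_)
  open import Relation.Nullary using (¬_; Dec; yes; no; does)
  open import Relation.Nullary.Decidable using (dec-true; dec-false)
  open import Algebra.Properties.CommutativeSemigroup ℕP.*-commutativeSemigroup
    using (x∙yz≈y∙xz) renaming (xy∙z≈xz∙y to ℕ-*-right-comm)

  if-yes : ∀ {a} {A : Set a} (d : Dec A) {x y : Carrier} → A → (if does d then x else y) ≈ x
  if-yes d a rewrite dec-true d a = refl

  if-no : ∀ {a} {A : Set a} (d : Dec A) {x y : Carrier} → ¬ A → (if does d then x else y) ≈ y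
  if-no d ¬a rewrite dec-false d ¬a = refl

  /-≡ : ∀ {a} b c .{{_ : ℕ.NonZero b}} → a ≡ c ℕ.* b → a ℕ./ b ≡ c
  /-≡ b c Eq.refl = m*n/n≡m c b

  ∑∣≤ : ℕ → ℕ → (ℕ → ℕ → Carrier) → Carrier
  ∑∣≤ N n g = ∑ N (λ i → if does (suc i ∣? n) then g (suc i) (n ℕ./ suc i) else 0#)

  ∑∣ : ℕ → (ℕ → ℕ → Carrier) → Carrier
  ∑∣ n = ∑∣≤ n n

  ∑∣-cong : ∀ n {g h} → (∀ d → d ∣ n → .{{_ : ℕ.NonZero d}} → g d (n ℕ./ d) ≈ h d (n ℕ./ d)) → ∑∣ n g ≈ ∑∣ n h
  ∑∣-cong n {g} {h} g≈h = ∑-cong n term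
    where
      term : ∀ i → i < n → (if does (suc i ∣? n) then g (suc i) (n ℕ./ suc i) else 0#)
                         ≈ (if does (suc i ∣? n) then h (suc i) (n ℕ./ suc i) else 0#)
      term i _ with suc i ∣? n
      ... | yes d∣n = trans (if-yes (suc i ∣? n) d∣n) (trans (g≈h (suc i) d∣n) (sym (if-yes (suc i ∣? n) d∣n)))
      ... | no  d∤n = trans (if-no (suc i ∣? n) d∤n) (sym (if-no (suc i ∣? n) d∤n))

  ∑∣-+ : ∀ n g h → ∑∣ n (λ d e → g d e + h d e) ≈ ∑∣ n g + ∑∣ n h
  ∑∣-+ n g h = trans (∑-cong n term) (∑-distrib-+ n _ _)
    where
      term : ∀ i → i < n → (if does (suc i ∣? n) then g (suc i) (n ℕ./ suc i) + h (suc i) (n ℕ./ suc i) else 0#)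
                         ≈ (if does (suc i ∣? n) then g (suc i) (n ℕ./ suc i) else 0#)
                           + (if does (suc i ∣? n) then h (suc i) (n ℕ./ suc i) else 0#)
      term i _ with suc i ∣? n
      ... | yes d∣n = trans (if-yes (suc i ∣? n) d∣n) (sym (+-cong (if-yes (suc i ∣? n) d∣n) (if-yes (suc i ∣? n) d∣n)))
      ... | no  d∤n = trans (if-no (suc i ∣? n) d∤n)
                            (sym (trans (+-cong (if-no (suc i ∣? n) d∤n) (if-no (suc i ∣? n) d∤n)) (+-identityˡ 0#)))

  ∑∣-*ˡ : ∀ n x g → ∑∣ n (λ d e → x * g d e) ≈ x * ∑∣ n g
  ∑∣-*ˡ n x g = trans (∑-cong n term) (∑-*ˡ n x _)
    where
      term : ∀ i → i < n → (if does (suc i ∣? n) then x * g (suc i) (n ℕ./ suc i) else 0#)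
                         ≈ x * (if does (suc i ∣? n) then g (suc i) (n ℕ./ suc i) else 0#)
      term i _ with suc i ∣? n
      ... | yes d∣n = trans (if-yes (suc i ∣? n) d∣n) (sym (*-cong refl (if-yes (suc i ∣? n) d∣n)))
      ... | no  d∤n = trans (if-no (suc i ∣? n) d∤n) (sym (trans (*-cong refl (if-no (suc i ∣? n) d∤n)) (zeroʳ x)))

  ∑∣≤-extend : ∀ n m g → ∑∣≤ (suc n ℕ.+ m) (suc n) g ≈ ∑∣ (suc n) g
  ∑∣≤-extend n m g = ∑-extend (suc n) m _ λ i n<i _ → if-no (suc i ∣? suc n) (λ d∣n → ℕP.<⇒≱ (s≤s n<i) (∣⇒≤ d∣n))

  module _ (p₀ : ℕ) where
    private
      p = suc p₀

      ∑∣-/p-term : ∀ m (g : ℕ → ℕ → Carrier) i →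
        (if does (suc i ∣? m ℕ.* p) then (if does (p ∣? (m ℕ.* p ℕ./ suc i)) then g (suc i) (m ℕ.* p ℕ./ suc i ℕ./ p) else 0#) else 0#)
        ≈ (if does (suc i ∣? m) then g (suc i) (m ℕ./ suc i) else 0#)
      ∑∣-/p-term m g i with suc i ∣? m
      ... | yes d∣m@(divides t m≡td) =
        trans (if-yes (suc i ∣? m ℕ.* p) d∣mp) (trans (if-yes (p ∣? (m ℕ.* p ℕ./ suc i)) p∣mp/d)
              (trans (reflexive (Eq.cong (g (suc i)) quotient)) (sym (if-yes (suc i ∣? m) d∣m))))
        where
          mp≡tpd : m ℕ.* p ≡ t ℕ.* p ℕ.* suc i
          mp≡tpd = Eq.trans (Eq.cong (ℕ._* p) m≡td) (ℕ-*-right-comm t (suc i) p)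
          d∣mp : suc i ∣ m ℕ.* p
          d∣mp = divides (t ℕ.* p) mp≡tpd
          p∣mp/d : p ∣ m ℕ.* p ℕ./ suc i
          p∣mp/d = divides t (/-≡ (suc i) (t ℕ.* p) mp≡tpd)
          quotient : m ℕ.* p ℕ./ suc i ℕ./ p ≡ m ℕ./ suc i
          quotient = Eq.trans (Eq.cong (ℕ._/ p) (/-≡ (suc i) (t ℕ.* p) mp≡tpd))
                              (Eq.trans (m*n/n≡m t p) (Eq.sym (/-≡ (suc i) t m≡td)))
      ... | no d∤m = trans inner (sym (if-no (suc i ∣? m) d∤m))
        where
          inner : (if does (suc i ∣? m ℕ.* p) then (if does (p ∣? (m ℕ.* p ℕ./ suc i)) then g (suc i) (m ℕ.* p ℕ./ suc i ℕ./ p) else 0#) else 0#) ≈ 0#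
          inner with suc i ∣? m ℕ.* p
          ... | no  d∤mp = if-no (suc i ∣? m ℕ.* p) d∤mp
          ... | yes d∣mp = trans (if-yes (suc i ∣? m ℕ.* p) d∣mp) (if-no (p ∣? (m ℕ.* p ℕ./ suc i)) p∤mp/d)
            where
              p∤mp/d : ¬ p ∣ m ℕ.* p ℕ./ suc i
              p∤mp/d (divides s mp/d≡sp) = d∤m (divides s (ℕP.*-cancelʳ-≡ m (s ℕ.* suc i) p
                (Eq.trans (Eq.sym (m/n*n≡m d∣mp)) (Eq.trans (Eq.cong (ℕ._* suc i) mp/d≡sp) (ℕ-*-right-comm s p (suc i))))))

      ∑∣-/p-multiple : ∀ m (g : ℕ → ℕ → Carrier) →
        ∑∣ (m ℕ.* p) (λ d e → if does (p ∣? e) then g d (e ℕ./ p) else 0#) ≈ ∑∣ m g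
      ∑∣-/p-multiple zero      g = refl
      ∑∣-/p-multiple m@(suc m′) g = trans (∑-cong (m ℕ.* p) (λ i _ → ∑∣-/p-term m g i))
        (trans (reflexive (Eq.cong (λ N → ∑∣≤ N m g) (ℕP.*-comm m p))) (∑∣≤-extend m′ (p₀ ℕ.* m) g))

    ∑∣-/p : ∀ n (g : ℕ → ℕ → Carrier) →
      ∑∣ n (λ d e → if does (p ∣? e) then g d (e ℕ./ p) else 0#) ≈ (if does (p ∣? n) then ∑∣ (n ℕ./ p) g else 0#)
    ∑∣-/p n g with p ∣? n
    ... | yes p∣n = trans (Eq.subst (λ N → ∑∣ N (λ d e → if does (p ∣? e) then g d (e ℕ./ p) else 0#) ≈ ∑∣ (n ℕ./ p) g)
                                   (m/n*n≡m p∣n) (∑∣-/p-multiple (n ℕ./ p) g))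
                          (sym (if-yes (p ∣? n) p∣n))
    ... | no  p∤n = trans (∑-zero n term) (sym (if-no (p ∣? n) p∤n))
      where
        term : ∀ i → i < n → (if does (suc i ∣? n) then (if does (p ∣? (n ℕ./ suc i)) then g (suc i) (n ℕ./ suc i ℕ./ p) else 0#) else 0#) ≈ 0#
        term i _ with suc i ∣? n
        ... | no  d∤n = if-no (suc i ∣? n) d∤n
        ... | yes d∣n = trans (if-yes (suc i ∣? n) d∣n) (if-no (p ∣? (n ℕ./ suc i))
                          λ p∣n/d → p∤n (∣-trans p∣n/d (divides (suc i) (Eq.sym (Eq.trans (ℕP.*-comm (suc i) _) (m/n*n≡m d∣n))))))

  module _ (p₀ : ℕ) (p-prime : Prime (suc p₀)) (n : ℕ) (g : ℕ → ℕ → Carrier) where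
    open import Data.Nat.Primality using (prime⇒irreducible)
    open import Data.Nat.Coprimality using (Coprime; coprime-divisor)
    open import Data.Sum using (inj₁; inj₂)
    open import Data.Product using (_,_)
    open import Data.Empty using (⊥-elim)
    open import Relation.Binary.PropositionalEquality using (_≢_)
    open import Relation.Binary.Reasoning.Setoid setoid

    private
      p = suc p₀
      pn = p ℕ.* n

      ∣p*⇒∣ : ∀ {d m} → ¬ p ∣ d → d ∣ p ℕ.* m → d ∣ m
      ∣p*⇒∣ {d} p∤d = coprime-divisor coprime
        where
          coprime : Coprime d p
          coprime {i} (i∣d , i∣p) with prime⇒irreducible p-prime i∣p
          ... | inj₁ i≡1    = i≡1
          ... | inj₂ Eq.refl = ⊥-elim (p∤d i∣d)

      term : ℕ → Carrier
      term i = if does (suc i ∣? pn) then g (suc i) (pn ℕ./ suc i) else 0#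
      term∣ term∤ : ℕ → Carrier
      term∣ i = if does (suc i ∣? n) then g (suc i) (p ℕ.* (n ℕ./ suc i)) else 0#
      term∤ i = if does (suc i ∣? n) then 0# else term i

      term-split : ∀ i → term i ≈ term∣ i + term∤ i
      term-split i with suc i ∣? n
      ... | yes d∣n@(divides q n≡qd) =
        trans (if-yes (suc i ∣? pn) d∣pn) (trans (reflexive (Eq.cong (g (suc i)) quotient))
              (sym (trans (+-cong (if-yes (suc i ∣? n) d∣n) (if-yes (suc i ∣? n) d∣n)) (+-identityʳ _))))
        where
          pn≡pqd : pn ≡ p ℕ.* q ℕ.* suc i
          pn≡pqd = Eq.trans (Eq.cong (p ℕ.*_) n≡qd) (Eq.sym (ℕP.*-assoc p q (suc i)))
          d∣pn : suc i ∣ pn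
          d∣pn = divides (p ℕ.* q) pn≡pqd
          quotient : pn ℕ./ suc i ≡ p ℕ.* (n ℕ./ suc i)
          quotient = Eq.trans (/-≡ (suc i) (p ℕ.* q) pn≡pqd) (Eq.cong (p ℕ.*_) (Eq.sym (/-≡ (suc i) q n≡qd)))
      ... | no d∤n = sym (trans (+-cong (if-no (suc i ∣? n) d∤n) (if-no (suc i ∣? n) d∤n)) (+-identityˡ _))

      term∤-nonmultiple : ∀ i → ¬ p ∣ suc i → term∤ i ≈ 0#
      term∤-nonmultiple i p∤d with suc i ∣? n
      ... | yes d∣n = if-yes (suc i ∣? n) d∣n
      ... | no  d∤n = trans (if-no (suc i ∣? n) d∤n) (if-no (suc i ∣? pn) (λ d∣pn → d∤n (∣p*⇒∣ p∤d d∣pn)))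

      term∤-at-divisor : ∀ j → suc j ∣ n →
        term∤ (p₀ ℕ.+ p ℕ.* j) ≈ (if does (p ∣? (n ℕ./ suc j)) then 0# else g (p ℕ.* suc j) (n ℕ./ suc j))
      term∤-at-divisor j (divides q n≡qd) with p ∣? (n ℕ./ suc j)
      ... | yes p∣n/d@(divides s n/d≡sp) = trans (if-yes (pd ∣? n) pd∣n) (sym (if-yes (p ∣? (n ℕ./ suc j)) p∣n/d))
        where
          pd = suc (p₀ ℕ.+ p ℕ.* j)
          pd∣n : pd ∣ n
          pd∣n = divides s (Eq.trans n≡qd (Eq.trans (Eq.cong (ℕ._* suc j) (Eq.trans (Eq.sym (/-≡ (suc j) q n≡qd)) n/d≡sp))
                                                    (Eq.trans (ℕP.*-assoc s p (suc j)) (Eq.cong (s ℕ.*_) (ℕP.*-suc p j)))))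
      ... | no p∤n/d = trans (if-no (pd ∣? n) pd∤n) (trans (if-yes (pd ∣? pn) pd∣pn)
                         (trans (reflexive (Eq.cong₂ g pd≡ quotient)) (sym (if-no (p ∣? (n ℕ./ suc j)) p∤n/d))))
        where
          pd = suc (p₀ ℕ.+ p ℕ.* j)
          pd≡ : pd ≡ p ℕ.* suc j
          pd≡ = Eq.sym (ℕP.*-suc p j)
          pd∤n : ¬ pd ∣ n
          pd∤n (divides t n≡tpd) = p∤n/d (divides t (Eq.trans (/-≡ (suc j) q n≡qd) (ℕP.*-cancelʳ-≡ q (t ℕ.* p) (suc j)
            (Eq.trans (Eq.sym n≡qd) (Eq.trans n≡tpd (Eq.trans (Eq.cong (t ℕ.*_) pd≡) (Eq.sym (ℕP.*-assoc t p (suc j)))))))))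
          pn≡qpd : pn ≡ q ℕ.* pd
          pn≡qpd = Eq.trans (Eq.cong (p ℕ.*_) n≡qd) (Eq.trans (x∙yz≈y∙xz p q (suc j)) (Eq.cong (q ℕ.*_) (Eq.sym pd≡)))
          pd∣pn : pd ∣ pn
          pd∣pn = divides q pn≡qpd
          quotient : pn ℕ./ pd ≡ n ℕ./ suc j
          quotient = Eq.trans (/-≡ pd q pn≡qpd) (Eq.sym (/-≡ (suc j) q n≡qd))

      term∤-multiple : ∀ j → term∤ (p₀ ℕ.+ p ℕ.* j) ≈
        (if does (suc j ∣? n) then (if does (p ∣? (n ℕ./ suc j)) then 0# else g (p ℕ.* suc j) (n ℕ./ suc j)) else 0#)
      term∤-multiple j with suc j ∣? n
      ... | no d∤n = trans vanish (sym (if-no (suc j ∣? n) d∤n))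
        where
          vanish : term∤ (p₀ ℕ.+ p ℕ.* j) ≈ 0#
          vanish with suc (p₀ ℕ.+ p ℕ.* j) ∣? n
          ... | yes pd∣n = if-yes (suc (p₀ ℕ.+ p ℕ.* j) ∣? n) pd∣n
          ... | no  pd∤n = trans (if-no (suc (p₀ ℕ.+ p ℕ.* j) ∣? n) pd∤n)
                             (if-no (suc (p₀ ℕ.+ p ℕ.* j) ∣? pn) (λ pd∣pn → d∤n (*-cancelˡ-∣ p (Eq.subst (_∣ pn) (Eq.sym (ℕP.*-suc p j)) pd∣pn))))
      ... | yes d∣n = trans (term∤-at-divisor j d∣n) (sym (if-yes (suc j ∣? n) d∣n))

    ∑∣-p* : ∑∣ pn g ≈ ∑∣ n (λ d e → g d (p ℕ.* e)) + ∑∣ n (λ d e → if does (p ∣? e) then 0# else g (p ℕ.* d) e)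
    ∑∣-p* = begin
      ∑ pn term                                          ≈⟨ ∑-cong pn (λ i _ → term-split i) ⟩
      ∑ pn (λ i → term∣ i + term∤ i)                     ≈⟨ ∑-distrib-+ pn term∣ term∤ ⟩
      ∑ pn term∣ + ∑ pn term∤                            ≈⟨ +-cong (∑-extend n (p₀ ℕ.* n) term∣ term∣-beyond)
                                                                   (∑-multiples p₀ n term∤ term∤-nonmultiple) ⟩
      ∑ n term∣ + ∑ n (λ j → term∤ (p₀ ℕ.+ p ℕ.* j))     ≈⟨ +-cong refl (∑-cong n (λ j _ → term∤-multiple j)) ⟩
      ∑∣ n (λ d e → g d (p ℕ.* e)) + ∑∣ n (λ d e → if does (p ∣? e) then 0# else g (p ℕ.* d) e) ∎
      where
        term∣-beyond : ∀ i → n ≤ i → i < n ℕ.+ p₀ ℕ.* n → term∣ i ≈ 0#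
        term∣-beyond i n≤i i<pn = if-no (suc i ∣? n) λ d∣n → ℕP.<⇒≱ (s≤s n≤i) (∣⇒≤ {{ℕ.≢-nonZero n≢0}} d∣n)
          where
            n≢0 : n ≢ 0
            n≢0 n≡0 = ℕP.n≮0 (Eq.subst (i <_) (Eq.trans (Eq.cong (p ℕ.*_) n≡0) (ℕP.*-zeroʳ p)) i<pn)

module DSquares where
  open import Data.Nat
  open import Data.Nat.Properties
  open import Data.Nat.Divisibility
  open import Data.Nat.Primality using (euclidsLemma; prime⇒irreducible; prime⇒nonTrivial)
  open import Data.Bool as Bool using (Bool; true; false)
  open import Data.Bool.Properties using (T-≡)
  open import Data.List using (map; upTo)
  open import Data.List.Membership.Propositional using (find; lose)
  open import Data.List.Membership.Propositional.Properties using (∈-map⁺; ∈-map⁻; ∈-upTo⁺)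
  open import Data.List.Relation.Unary.Any.Properties using (any⁺; any⁻)
  open import Data.Sum using (_⊎_; inj₁; inj₂; reduce)
  open import Data.Product using (∃; _,_)
  open import Data.Empty using (⊥-elim)
  open import Function.Bundles using (Equivalence)
  open import Relation.Nullary using (¬_; yes; no)
  open Eq

  absD≡1⊎absD≡3 : ∀ k → absD k ≡ 1 ⊎ absD k ≡ 3
  absD≡1⊎absD≡3 k with isEven k
  ... | true  = inj₁ refl
  ... | false = inj₂ refl

  p²∤De² : ∀ k {p e} → Prime p → ¬ p ∣ e → ¬ p * p ∣ absD k * (e * e)
  p²∤De² k {p} {e} p-prime p∤e p²∣De² with euclidsLemma (absD k) (e * e) p-prime (∣-trans (n∣m*n p) p²∣De²)
  ... | inj₂ p∣e² = p∤e (reduce (euclidsLemma e e p-prime p∣e²))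
  ... | inj₁ p∣D with absD≡1⊎absD≡3 k
  ...   | inj₁ D≡1 = <⇒≱ (nonTrivial⇒n>1 p {{prime⇒nonTrivial p-prime}}) (∣⇒≤ (subst (p ∣_) D≡1 p∣D))
  ...   | inj₂ D≡3 with prime⇒irreducible prime[3] (subst (p ∣_) D≡3 p∣D)
  ...     | inj₁ refl = <⇒≱ (nonTrivial⇒n>1 p {{prime⇒nonTrivial p-prime}}) ≤-refl
  ...     | inj₂ refl = p∤e (reduce
                          (euclidsLemma e e p-prime (*-cancelˡ-∣ 3 (subst (λ D → 9 ∣ D * (e * e)) D≡3 p²∣De²))))

  private
    IsDRoot : ℕ → ℕ → ℕ → Bool
    IsDRoot k n m = absD k * (m * m) ≡ᵇ n

    1≤absD : ∀ k → 1 ≤ absD k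
    1≤absD k with absD≡1⊎absD≡3 k
    ... | inj₁ D≡1 = subst (1 ≤_) (sym D≡1) ≤-refl
    ... | inj₂ D≡3 = subst (1 ≤_) (sym D≡3) (s≤s z≤n)

  isDSquare-De² : ∀ k j → isDSquare k (absD k * (suc j * suc j)) ≡ true
  isDSquare-De² k j = Equivalence.to T-≡ (any⁺ (IsDRoot k N) (lose (∈-map⁺ suc (∈-upTo⁺ j<N)) (≡⇒≡ᵇ N N refl)))
    where
      N = absD k * (suc j * suc j)
      j<N : j < N
      j<N = <-≤-trans (n<1+n j) (≤-trans (m≤m*n (suc j) (suc j)) (subst (_≤ N) (*-identityˡ _) (*-monoˡ-≤ (suc j * suc j) (1≤absD k))))

  isDSquare⇒ : ∀ k n → isDSquare k n ≡ true → ∃ λ j → absD k * (suc j * suc j) ≡ n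
  isDSquare⇒ k n isSq with find (any⁻ (IsDRoot k n) (map suc (upTo n)) (Equivalence.from T-≡ isSq))
  ... | m , m∈ , root with ∈-map⁻ suc m∈
  ...   | j , _ , refl = j , ≡ᵇ⇒≡ _ n root

  private
    ≡true-ext : ∀ {a b : Bool} → (a ≡ true → b ≡ true) → (b ≡ true → a ≡ true) → a ≡ b
    ≡true-ext {true}  {true}  _ _ = refl
    ≡true-ext {false} {false} _ _ = refl
    ≡true-ext {true}  {false} a⇒b _ with a⇒b refl
    ... | ()
    ≡true-ext {false} {true}  _ b⇒a with b⇒a refl
    ... | ()

  isDSquare-p²* : ∀ k {p₀} → Prime (suc p₀) → ∀ m → isDSquare k m ≡ isDSquare k (suc p₀ * suc p₀ * m)
  isDSquare-p²* k {p₀} p-prime m = ≡true-ext to from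
    where
      p = suc p₀
      to : isDSquare k m ≡ true → isDSquare k (p * p * m) ≡ true
      to sq with isDSquare⇒ k m sq
      ... | j , De²≡m = subst (λ n → isDSquare k n ≡ true) (trans (identity (absD k) p (suc j)) (cong (p * p *_) De²≡m))
                          (isDSquare-De² k (j + p₀ * suc j))
        where
          identity : ∀ D p s → D * (p * s * (p * s)) ≡ p * p * (D * (s * s))
          identity = solve-∀
      from : isDSquare k (p * p * m) ≡ true → isDSquare k m ≡ true
      from sq with isDSquare⇒ k (p * p * m) sq
      ... | j , De²≡p²m with p ∣? suc j
      ...   | no p∤j+1 = ⊥-elim (p²∤De² k p-prime p∤j+1 (divides m (trans De²≡p²m (*-comm (p * p) m))))
      ...   | yes (divides (suc t) j+1≡tp) = subst (λ n → isDSquare k n ≡ true) De²≡m (isDSquare-De² k t)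
        where
          identity : ∀ D t p → p * p * (D * (t * t)) ≡ D * (t * p * (t * p))
          identity = solve-∀
          De²≡m : absD k * (suc t * suc t) ≡ m
          De²≡m = *-cancelˡ-≡ _ m (p * p)
                    (trans (identity (absD k) (suc t) p) (trans (cong (λ x → absD k * (x * x)) (sym j+1≡tp)) De²≡p²m))

module PsiAsDivisorSum {c ℓ : Level} (R : CommutativeRing c ℓ) (k : ℕ) where
  open CommutativeRing R hiding (zero)
  open FiniteSum commutativeSemiring using (foldr-applyUpTo)
  open DivisorSum R
  open import Data.Integer as ℤ using (ℤ; -[1+_])
  open import Data.Nat.Divisibility using (_∣_; divides)
  open import Data.Bool using (if_then_else_)
  open DSquares using (isDSquare-De²)

  weight : ℕ → ℤ
  weight d = kronD k d ℤ.* ℤ.+ (d ℕ.^ (k ℕ.∸ 1))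

  ψTerm : Series R → ℕ → ℕ → Carrier
  ψTerm f d e = ι R (weight d) * f (ℤ.+ (absD k ℕ.* (e ℕ.* e)))

  Ψ-∑∣ : ∀ f n → Ψ R k f (ℤ.+ n) ≈ ∑∣ n (ψTerm f)
  Ψ-∑∣ f zero    = refl
  Ψ-∑∣ f (suc m) = foldr-applyUpTo _ (λ i → i) (suc m)

  Ψ-square : ∀ f → _≋_ R (Ψ R k f) (Ψ R k (square R k f))
  Ψ-square f (ℤ.+ zero)    = refl
  Ψ-square f -[1+ m ]      = refl
  Ψ-square f (ℤ.+ (suc m)) = trans (Ψ-∑∣ f (suc m))
    (trans (∑∣-cong (suc m) {ψTerm f} {ψTerm (square R k f)} same-term) (sym (Ψ-∑∣ (square R k f) (suc m))))
    where
      same-term : ∀ d → d ∣ suc m → .{{_ : ℕ.NonZero d}} → ψTerm f d (suc m ℕ./ d) ≈ ψTerm (square R k f) d (suc m ℕ./ d)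
      same-term d (divides q m+1≡qd) with suc m ℕ./ d | /-≡ d q m+1≡qd
      ... | .q | Eq.refl with q | m+1≡qd
      ...   | zero   | ()
      ...   | suc q′ | _ = *-cong refl (sym (reflexive
                              (Eq.cong (λ b → if b then f (ℤ.+ (absD k ℕ.* (suc q′ ℕ.* suc q′))) else 0#) (isDSquare-De² k q′))))

module HeckeOperators {c ℓ : Level} (R : CommutativeRing c ℓ) (k p₀ : ℕ) (p-prime : Prime (suc p₀)) where
  open CommutativeRing R hiding (zero)
  open Embedding R
  open DivisorSum R
  open import Data.Nat.Divisibility using (_∣_; _∣?_; divides)
  open import Data.Integer as ℤ using (-[1+_])
  import Data.Integer.Properties as ℤP
  open import Data.Bool using (if_then_else_)
  open import Relation.Nullary using (yes; no; does)
  open import Relation.Binary.Reasoning.Setoid setoid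
  open import Algebra.Properties.CommutativeSemigroup *-commutativeSemigroup using (interchange; x∙yz≈y∙xz)
  open KroneckerMultiplicative using (kronD-*)
  open KroneckerOnDSquares using (chiP-D-square-∣; chiP-D-square-∤)
  open DSquares using (p²∤De²)
  open PsiAsDivisorSum R k

  p : ℕ
  p = suc p₀

  p^[k-1] p^[2k-1] : Carrier
  p^[k-1]  = ι R (ℤ.+ (p ℕ.^ (k ℕ.∸ 1)))
  p^[2k-1] = ι R (ℤ.+ (p ℕ.^ (2 ℕ.* k ℕ.∸ 1)))

  weight-p* : ∀ d → ι R (weight (p ℕ.* d)) ≈ (ι R (kronD k p) * p^[k-1]) * ι R (weight d)
  weight-p* d = begin
      ι R (weight (p ℕ.* d))                        ≡⟨ Eq.cong (ι R) (Eq.cong₂ ℤ._*_ (kronD-* k p d) powers) ⟩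
      ι R ((χp ℤ.* χd) ℤ.* (pᵏ ℤ.* dᵏ))             ≈⟨ trans (ι-* (χp ℤ.* χd) (pᵏ ℤ.* dᵏ)) (*-cong (ι-* χp χd) (ι-* pᵏ dᵏ)) ⟩
      (ι R χp * ι R χd) * (p^[k-1] * ι R dᵏ)        ≈⟨ interchange (ι R χp) (ι R χd) p^[k-1] (ι R dᵏ) ⟩
      (ι R χp * p^[k-1]) * (ι R χd * ι R dᵏ)        ≈⟨ *-cong refl (ι-* χd dᵏ) ⟨
      (ι R χp * p^[k-1]) * ι R (weight d)           ∎
    where
      χp = kronD k p
      χd = kronD k d
      pᵏ = ℤ.+ (p ℕ.^ (k ℕ.∸ 1))
      dᵏ = ℤ.+ (d ℕ.^ (k ℕ.∸ 1))
      ^-distribʳ-* : ∀ a b n → (a ℕ.* b) ℕ.^ n ≡ a ℕ.^ n ℕ.* b ℕ.^ n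
      ^-distribʳ-* a b zero    = Eq.refl
      ^-distribʳ-* a b (suc n) = Eq.trans (Eq.cong (a ℕ.* b ℕ.*_) (^-distribʳ-* a b n)) (ℕ-interchange a b _ _)
        where open import Algebra.Properties.CommutativeSemigroup ℕP.*-commutativeSemigroup
                using () renaming (interchange to ℕ-interchange)
      powers : ℤ.+ ((p ℕ.* d) ℕ.^ (k ℕ.∸ 1)) ≡ pᵏ ℤ.* dᵏ
      powers = Eq.trans (Eq.cong ℤ.+_ (^-distribʳ-* p d (k ℕ.∸ 1))) (ℤP.pos-* (p ℕ.^ (k ℕ.∸ 1)) (d ℕ.^ (k ℕ.∸ 1)))

  module _ (f : Series R) (d e : ℕ) where
    private
      X = absD k ℕ.* (e ℕ.* e)
      w = ι R (weight d)

    ψTerm-U : w * U R (p ℕ.* p) f (ℤ.+ X) ≈ ψTerm f d (p ℕ.* e)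
    ψTerm-U = reflexive (Eq.cong (λ n → w * f n) (Eq.trans (Eq.sym (ℤP.pos-* (p ℕ.* p) X)) (Eq.cong ℤ.+_ (identity p (absD k) e))))
      where
        identity : ∀ p D e → p ℕ.* p ℕ.* (D ℕ.* (e ℕ.* e)) ≡ D ℕ.* (p ℕ.* e ℕ.* (p ℕ.* e))
        identity = solve-∀

    ψTerm-χ : w * (p^[k-1] * twist R (chiP k p) f (ℤ.+ X)) ≈ (if does (p ∣? e) then 0# else ψTerm f (p ℕ.* d) e)
    ψTerm-χ with p ∣? e
    ... | yes p∣e = begin
      w * (p^[k-1] * (ι R (chiP k p (ℤ.+ X)) * f (ℤ.+ X)))   ≡⟨ Eq.cong (λ χ → w * (p^[k-1] * (ι R χ * f (ℤ.+ X)))) (chiP-D-square-∣ k p-prime p∣e) ⟩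
      w * (p^[k-1] * (0# * f (ℤ.+ X)))                       ≈⟨ trans (*-cong refl (trans (*-cong refl (zeroˡ _)) (zeroʳ _))) (zeroʳ w) ⟩
      0#                                                     ≈⟨ if-yes (p ∣? e) p∣e ⟨
      (if does (p ∣? e) then 0# else ψTerm f (p ℕ.* d) e)    ∎
    ... | no p∤e = begin
      w * (p^[k-1] * (ι R (chiP k p (ℤ.+ X)) * f (ℤ.+ X)))   ≡⟨ Eq.cong (λ χ → w * (p^[k-1] * (ι R χ * f (ℤ.+ X)))) (chiP-D-square-∤ k p-prime p∤e) ⟩
      w * (p^[k-1] * (ι R (kronD k p) * f (ℤ.+ X)))          ≈⟨ regroup w p^[k-1] (ι R (kronD k p)) (f (ℤ.+ X)) ⟩
      (ι R (kronD k p) * p^[k-1]) * w * f (ℤ.+ X)            ≈⟨ *-cong (weight-p* d) refl ⟨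
      ψTerm f (p ℕ.* d) e                                    ≈⟨ if-no (p ∣? e) p∤e ⟨
      (if does (p ∣? e) then 0# else ψTerm f (p ℕ.* d) e)    ∎
      where
        regroup : ∀ a b c x → a * (b * (c * x)) ≈ ((c * b) * a) * x
        regroup a b c x = trans (*-cong refl (sym (*-assoc b c x))) (trans (sym (*-assoc a (b * c) x))
                            (*-cong (trans (*-comm a (b * c)) (*-cong (*-comm b c) refl)) refl))

    ψTerm-V : w * V R (p ℕ.* p) f (ℤ.+ X) ≈ (if does (p ∣? e) then ψTerm f d (e ℕ./ p) else 0#)
    ψTerm-V with p ∣? e
    ... | yes p∣e@(divides t e≡tp) =
      trans (*-cong refl (trans (if-yes ((p ℕ.* p) ∣? X) p²∣X) (reflexive (Eq.cong (λ n → f (ℤ.+ n)) X/p²))))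
            (trans (reflexive (Eq.cong (ψTerm f d) (Eq.sym (/-≡ p t e≡tp)))) (sym (if-yes (p ∣? e) p∣e)))
      where
        identity : ∀ D t p → D ℕ.* (t ℕ.* p ℕ.* (t ℕ.* p)) ≡ D ℕ.* (t ℕ.* t) ℕ.* (p ℕ.* p)
        identity = solve-∀
        X≡Dt²p² : X ≡ absD k ℕ.* (t ℕ.* t) ℕ.* (p ℕ.* p)
        X≡Dt²p² = Eq.trans (Eq.cong (λ x → absD k ℕ.* (x ℕ.* x)) e≡tp) (identity (absD k) t p)
        p²∣X : p ℕ.* p ∣ X
        p²∣X = divides (absD k ℕ.* (t ℕ.* t)) X≡Dt²p²
        X/p² : X ℕ./ (p ℕ.* p) ≡ absD k ℕ.* (t ℕ.* t)
        X/p² = /-≡ (p ℕ.* p) (absD k ℕ.* (t ℕ.* t)) X≡Dt²p²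
    ... | no p∤e = trans (*-cong refl (if-no ((p ℕ.* p) ∣? X) (p²∤De² k p-prime p∤e)))
                         (trans (zeroʳ w) (sym (if-no (p ∣? e) p∤e)))

    ψTerm-T : w * T R k p f (ℤ.+ X) ≈
      (ψTerm f d (p ℕ.* e) + (if does (p ∣? e) then 0# else ψTerm f (p ℕ.* d) e))
        + p^[2k-1] * (if does (p ∣? e) then ψTerm f d (e ℕ./ p) else 0#)
    ψTerm-T = trans (distribˡ w _ _)
      (+-cong (trans (distribˡ w _ _) (+-cong ψTerm-U ψTerm-χ))
              (trans (x∙yz≈y∙xz w p^[2k-1] _) (*-cong refl ψTerm-V)))

  Ψ-T-+ : ∀ f n → Ψ R k (T R k p f) (ℤ.+ n) ≈ 𝒯 R k p (Ψ R k f) (ℤ.+ n)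
  Ψ-T-+ f n = begin
      Ψ R k (T R k p f) (ℤ.+ n)                                     ≈⟨ Ψ-∑∣ (T R k p f) n ⟩
      ∑∣ n (ψTerm (T R k p f))                                      ≈⟨ ∑∣-cong n {ψTerm (T R k p f)} {λ d e → (ψTerm f d (p ℕ.* e) + B d e) + p^[2k-1] * C d e}
                                                                         (λ d _ → ψTerm-T f d (n ℕ./ d)) ⟩
      ∑∣ n (λ d e → (ψTerm f d (p ℕ.* e) + B d e) + p^[2k-1] * C d e)
                                                                    ≈⟨ ∑∣-+ n (λ d e → ψTerm f d (p ℕ.* e) + B d e) (λ d e → p^[2k-1] * C d e) ⟩
      ∑∣ n (λ d e → ψTerm f d (p ℕ.* e) + B d e) + ∑∣ n (λ d e → p^[2k-1] * C d e)
                                                                    ≈⟨ +-cong (∑∣-+ n (λ d e → ψTerm f d (p ℕ.* e)) B) (∑∣-*ˡ n p^[2k-1] C) ⟩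
      (∑∣ n (λ d e → ψTerm f d (p ℕ.* e)) + ∑∣ n B) + p^[2k-1] * ∑∣ n C
                                                                    ≈⟨ +-cong (sym (∑∣-p* p₀ p-prime n (ψTerm f))) (*-cong refl (∑∣-/p p₀ n (ψTerm f))) ⟩
      ∑∣ (p ℕ.* n) (ψTerm f) + p^[2k-1] * (if does (p ∣? n) then ∑∣ (n ℕ./ p) (ψTerm f) else 0#)
                                                                    ≈⟨ +-cong (Ψ-∑∣ f (p ℕ.* n)) (*-cong refl (if-cong (Ψ-∑∣ f (n ℕ./ p)))) ⟨
      Ψ R k f (ℤ.+ (p ℕ.* n)) + p^[2k-1] * (if does (p ∣? n) then Ψ R k f (ℤ.+ (n ℕ./ p)) else 0#)
                                                                    ≡⟨ Eq.cong (λ m → Ψ R k f m + p^[2k-1] * (if does (p ∣? n) then Ψ R k f (ℤ.+ (n ℕ./ p)) else 0#))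
                                                                                (ℤP.pos-* p n) ⟩
      𝒯 R k p (Ψ R k f) (ℤ.+ n)                                     ∎
    where
      B C : ℕ → ℕ → Carrier
      B d e = if does (p ∣? e) then 0# else ψTerm f (p ℕ.* d) e
      C d e = if does (p ∣? e) then ψTerm f d (e ℕ./ p) else 0#
      if-cong : ∀ {b x y} → x ≈ y → (if b then x else 0#) ≈ (if b then y else 0#)
      if-cong {Data.Bool.true}  x≈y = x≈y
      if-cong {Data.Bool.false} _   = refl

  Ψ-T : ∀ f → _≋_ R (Ψ R k (T R k p f)) (𝒯 R k p (Ψ R k f))
  Ψ-T f (ℤ.+ n)    = Ψ-T-+ f n
  Ψ-T f -[1+ m ]   = sym (trans (+-identityˡ _) (trans (*-cong refl V≈0) (zeroʳ p^[2k-1])))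
    where
      Ψ-ℤ- : ∀ x → Ψ R k f (ℤ.- ℤ.+ x) ≈ 0#
      Ψ-ℤ- zero    = refl
      Ψ-ℤ- (suc x) = refl
      Ψ-negative/p : Ψ R k f (-[1+ m ] ℤ./ℕ p) ≈ 0#
      Ψ-negative/p with suc m ℕ.% p
      ... | zero  = Ψ-ℤ- (suc m ℕ./ p)
      ... | suc _ = refl
      V≈0 : (if does (p ∣? suc m) then Ψ R k f (-[1+ m ] ℤ./ℕ p) else 0#) ≈ 0#
      V≈0 with does (p ∣? suc m)
      ... | Data.Bool.true  = Ψ-negative/p
      ... | Data.Bool.false = refl

  𝒯-cong : ∀ {F G} → _≋_ R F G → _≋_ R (𝒯 R k p F) (𝒯 R k p G)
  𝒯-cong {F} {G} F≋G z = +-cong (F≋G (ℤ.+ p ℤ.* z)) (*-cong refl V-cong)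
    where
      V-cong : V R p F z ≈ V R p G z
      V-cong with does (p ∣? ℤ.∣ z ∣)
      ... | Data.Bool.true  = F≋G (z ℤ./ℕ p)
      ... | Data.Bool.false = refl

  Ψ-Tⁿ : ∀ f n → _≋_ R (iter n (𝒯 R k p) (Ψ R k f)) (Ψ R k (iter n (T R k p) f))
  Ψ-Tⁿ f zero    z = refl
  Ψ-Tⁿ f (suc n) z = trans (𝒯-cong (Ψ-Tⁿ f n) z) (sym (Ψ-T (iter n (T R k p) f) z))

module SquarePart {c ℓ : Level} (R : CommutativeRing c ℓ) (k : ℕ) where
  open CommutativeRing R hiding (zero)
  open DivisorSum R using (if-yes; if-no; /-≡)
  open import Data.Integer as ℤ using (-[1+_])
  import Data.Integer.Properties as ℤP
  open import Data.Nat.Divisibility using (_∣?_; divides)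
  open import Data.Bool using (true; false; if_then_else_)
  open import Relation.Nullary using (yes; no; does)
  open DSquares using (isDSquare-p²*)

  private
    if-cong : ∀ b {x y : Carrier} → x ≈ y → (if b then x else 0#) ≈ (if b then y else 0#)
    if-cong true  x≈y = x≈y
    if-cong false _   = refl

    square-ℤ- : ∀ f x → square R k f (ℤ.- ℤ.+ x) ≈ 0#
    square-ℤ- f zero    = refl
    square-ℤ- f (suc x) = refl

  square-⊕ : ∀ F G → _≋_ R (square R k (_⊕_ R F G)) (_⊕_ R (square R k F) (square R k G))
  square-⊕ F G (ℤ.+ m)  = by-case (isDSquare k m)
    where
      by-case : ∀ b → (if b then F (ℤ.+ m) + G (ℤ.+ m) else 0#) ≈ (if b then F (ℤ.+ m) else 0#) + (if b then G (ℤ.+ m) else 0#)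
      by-case true  = refl
      by-case false = sym (+-identityˡ 0#)
  square-⊕ F G -[1+ m ] = sym (+-identityˡ 0#)

  square-⊙ : ∀ x F → _≋_ R (square R k (_⊙_ R x F)) (_⊙_ R x (square R k F))
  square-⊙ x F (ℤ.+ m)  = by-case (isDSquare k m)
    where
      by-case : ∀ b → (if b then x * F (ℤ.+ m) else 0#) ≈ x * (if b then F (ℤ.+ m) else 0#)
      by-case true  = refl
      by-case false = sym (zeroʳ x)
  square-⊙ x F -[1+ m ] = sym (zeroʳ x)

  square-twist : ∀ χ f → _≋_ R (square R k (twist R χ f)) (twist R χ (square R k f))
  square-twist χ f (ℤ.+ m)  = by-case (isDSquare k m)
    where
      by-case : ∀ b → (if b then ι R (χ (ℤ.+ m)) * f (ℤ.+ m) else 0#) ≈ ι R (χ (ℤ.+ m)) * (if b then f (ℤ.+ m) else 0#)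
      by-case true  = refl
      by-case false = sym (zeroʳ _)
  square-twist χ f -[1+ m ] = sym (zeroʳ _)

  module _ (p₀ : ℕ) (p-prime : Prime (suc p₀)) where
    private
      p² = suc p₀ ℕ.* suc p₀

    square-U : ∀ f → _≋_ R (square R k (U R p² f)) (U R p² (square R k f))
    square-U f (ℤ.+ m)  = trans (reflexive (Eq.cong₂ (λ b n → if b then f n else 0#) (isDSquare-p²* k p-prime m) (Eq.sym (ℤP.pos-* p² m))))
                                (reflexive (Eq.cong (square R k f) (ℤP.pos-* p² m)))
    square-U f -[1+ m ] = refl

    square-V : ∀ f → _≋_ R (square R k (V R p² f)) (V R p² (square R k f))
    square-V f (ℤ.+ m) with p² ∣? m
    ... | no p²∤m = trans (if-cong (isDSquare k m) (if-no (p² ∣? m) p²∤m)) (trans (if-0 (isDSquare k m)) (sym (if-no (p² ∣? m) p²∤m)))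
      where
        if-0 : ∀ b → (if b then 0# else 0#) ≈ 0#
        if-0 true  = refl
        if-0 false = refl
    ... | yes p²∣m@(divides t m≡tp²) =
      trans (if-cong (isDSquare k m) (if-yes (p² ∣? m) p²∣m))
            (trans (reflexive (Eq.cong (λ b → if b then f (ℤ.+ (m ℕ./ p²)) else 0#) same-square)) (sym (if-yes (p² ∣? m) p²∣m)))
      where
        same-square : isDSquare k m ≡ isDSquare k (m ℕ./ p²)
        same-square = Eq.trans (Eq.cong (isDSquare k) (Eq.trans m≡tp² (ℕP.*-comm t p²)))
                        (Eq.trans (Eq.sym (isDSquare-p²* k p-prime t)) (Eq.cong (isDSquare k) (Eq.sym (/-≡ p² t m≡tp²))))
    square-V f -[1+ m ] = sym vanish
      where
        vanish : (if does (p² ∣? suc m) then square R k f (-[1+ m ] ℤ./ℕ p²) else 0#) ≈ 0#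
        vanish with does (p² ∣? suc m)
        ... | false = refl
        ... | true  with suc m ℕ.% p²
        ...   | zero  = square-ℤ- f (suc m ℕ./ p²)
        ...   | suc _ = refl

    square-T : ∀ f → _≋_ R (square R k (T R k (suc p₀) f)) (T R k (suc p₀) (square R k f))
    square-T f z = trans (square-⊕ _ _ z)
      (+-cong (trans (square-⊕ _ _ z) (+-cong (square-U f z) (trans (square-⊙ _ _ z) (*-cong refl (square-twist (chiP k (suc p₀)) f z)))))
              (trans (square-⊙ _ _ z) (*-cong refl (square-V f z))))

module IntegerCoefficients where
  open import Data.Integer as ℤ using (+_)
  open import Data.Integer.Properties using (+-*-commutativeRing)
  open import Data.Integer.Divisibility using (_∣_)
  import Data.Integer.Divisibility.Signed as Signed
  import Data.Nat.Divisibility as ℕ∣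
  open import Data.Integer.Tactic.RingSolver renaming (solve-∀ to ℤ-solve-∀)

  private
    ℤR = +-*-commutativeRing

    ι≡+ : ∀ n → ι ℤR (+ n) ≡ + n
    ι≡+ zero    = Eq.refl
    ι≡+ (suc n) = Eq.cong (λ i → ℤ.1ℤ ℤ.+ i) (ι≡+ n)

    p∣ιp^[1+j] : ∀ p j → + p Signed.∣ ι ℤR (+ (p ℕ.^ suc j))
    p∣ιp^[1+j] p j = Eq.subst (+ p Signed.∣_) (Eq.sym (ι≡+ (p ℕ.^ suc j))) (Signed.∣ᵤ⇒∣ (ℕ∣.divides (p ℕ.^ j) (ℕP.*-comm p _)))

  T≡U[mod-p] : ∀ k p (g : Series ℤR) → 2 ≤ k → ∀ n → + p ∣ (T ℤR k p g n ℤ.- U ℤR (p ℕ.* p) g n)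
  T≡U[mod-p] (suc zero) p g (s≤s ()) n
  T≡U[mod-p] k@(suc (suc k′)) p g _ n =
    Eq.subst (+ p ∣_) (Eq.sym (identity u a b)) (Signed.∣⇒∣ᵤ (Signed.∣m∣n⇒∣m+n {+ p} {a} {b}
      (Signed.∣m⇒∣m*n (twist ℤR (chiP k p) g n) (p∣ιp^[1+j] p k′))
      (Signed.∣m⇒∣m*n (V ℤR (p ℕ.* p) g n) (p∣ιp^[1+j] p (k′ ℕ.+ suc (suc (k′ ℕ.+ 0)))))))
    where
      u = U ℤR (p ℕ.* p) g n
      a = ι ℤR (+ (p ℕ.^ (k ℕ.∸ 1))) ℤ.* twist ℤR (chiP k p) g n
      b = ι ℤR (+ (p ℕ.^ (2 ℕ.* k ℕ.∸ 1))) ℤ.* V ℤR (p ℕ.* p) g n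
      identity : ∀ u a b → u ℤ.+ a ℤ.+ b ℤ.- u ≡ a ℤ.+ b
      identity = ℤ-solve-∀

open import Data.Nat using (_*_)
open import Data.Integer using (ℤ; +_; _-_; ∣_∣)
open import Data.Integer.Properties using (+-*-commutativeRing)
open import Data.Integer.Divisibility using (_∣_)
open import Data.Product using (_×_; _,_)
open import Data.Nat.Primality using (¬prime[0])
open import Data.Empty using (⊥-elim)
open HeckeOperators using (Ψ-Tⁿ)
open PsiAsDivisorSum using (Ψ-square)
open SquarePart using (square-U; square-V; square-twist; square-T)
open IntegerCoefficients using (T≡U[mod-p])

-- The identities hold for all formal series.
lemma4 : ∀ {c ℓ} (R : CommutativeRing c ℓ) (k : ℕ) → 1 ≤ k → (p : ℕ) → Prime p →
    (f : Series R) → IsLaurent R f →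
      (∀ n → 1 ≤ n →
        _≋_ R (iter n (𝒯 R k p) (Ψ R k f)) (Ψ R k (iter n (T R k p) f)))
    × _≋_ R (Ψ R k f) (Ψ R k (square R k f))
    × (_≋_ R (square R k (U R (p * p) f)) (U R (p * p) (square R k f))
       × _≋_ R (square R k (V R (p * p) f)) (V R (p * p) (square R k f))
       × _≋_ R (square R k (twist R (chiP k p) f)) (twist R (chiP k p) (square R k f))
       × _≋_ R (square R k (T R k p f)) (T R k p (square R k f)))
    × ((g : Series +-*-commutativeRing) → IsLaurent +-*-commutativeRing g → 2 ≤ k →
        ∀ n → + p ∣ (T +-*-commutativeRing k p g n - U +-*-commutativeRing (p * p) g n))
lemma4 R k _ zero      0-prime  f _ = ⊥-elim (¬prime[0] 0-prime)
lemma4 R k _ (suc p₀) p-prime f _ =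
    (λ n _ → Ψ-Tⁿ R k p₀ p-prime f n)
  , Ψ-square R k f
  , (square-U R k p₀ p-prime f , square-V R k p₀ p-prime f , square-twist R k (chiP k (suc p₀)) f , square-T R k p₀ p-prime f)
  , λ g _ → T≡U[mod-p] k (suc p₀) g
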